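{- Let $\mathcal{F}[\mathbf{G}]$ be the vector space with basis the isomorphism classes of mixed graphs. For mixed graphs $G,H$ define $G\curvearrowright H$ by $V(G\curvearrowright H)=V(G)\sqcup V(H)$, $E(G\curvearrowright H)=E(G)\sqcup E(H)$, $A(G\curvearrowright H)=A(G)\sqcup A(H)\sqcup(V(G)\times V(H))$, extended bilinearly. Then $\curvearrowright$ is associative with unit the empty graph $1$, and for all $x,y\in\mathcal{F}[\mathbf{G}]$, \[\Delta(x\curvearrowright y)=(x\otimes 1)\curvearrowright\Delta(y)+\Delta(x)\curvearrowright(1\otimes y)-x\otimes y,\] where $\curvearrowright$ acts componentwise on $\mathcal{F}[\mathbf{G}]\otimes\mathcal{F}[\mathbf{G}]$. Hence $(\mathcal{F}[\mathbf{G}],\curvearrowright,\Delta)$ is a unital infinitesimal bialgebra.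
   Context: A mixed graph $G$ has a finite vertex set $V(G)$, a set $E(G)$ of edges (2-element subsets) and a set $A(G)$ of arcs (ordered pairs of distinct vertices), no pair being both an edge and carrying an arc. For $I\subseteq V(G)$, $G_{\mid I}$ is the induced mixed graph; $I$ is an ideal of $G$ if $x\in I$ and $(x,y)\in A(G)$ imply $y\in I$. The coproduct on $\mathcal{F}[\mathbf{G}]$ is $\Delta(G)=\sum_{I\text{ ideal of }G}G_{\mid V(G)\setminus I}\otimes G_{\mid I}$. A unital infinitesimal bialgebra (Loday–Ronco) is a unital associative algebra with a counital coassociative coproduct satisfying the displayed compatibility. -}

module Defs where

open import Level using (Level; _⊔_)
open import Data.Bool using (Bool; true; false)
open import Data.Nat using (ℕ; zero; suc) renaming (_+_ to _+ℕ_)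
open import Data.Fin using (Fin; zero; suc; splitAt)
open import Data.Fin.Subset using (Subset; _∈_; ∁)
open import Data.Fin.Subset.Properties using (_∈?_)
open import Data.Fin.Properties using (all?)
open import Data.Sum using (inj₁; inj₂)
open import Data.Product using (_×_; _,_; Σ; ∃)
open import Data.List using (List; []; _∷_; _++_; map; concatMap; filter)
open import Data.Vec using ([]; _∷_)
open import Relation.Binary.PropositionalEquality using (_≡_; refl)
open import Relation.Nullary using (¬_; Dec)
open import Relation.Nullary.Decidable using (_→-dec_)
open import Relation.Unary using (Decidable)
open import Function.Bundles using (_↔_; Inverse)
open import Algebra.Bundles using (CommutativeRing)
import Data.Bool.Properties as BoolP

-- E x y ≡ true  : {x,y} is an edge   (symmetric, irreflexive)
--   A x y ≡ true  : (x,y) is an arc    (irreflexive)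
--   no pair is both an edge and carries an arc.

record MixedGraph : Set where
  constructor mkGraph
  field
    n        : ℕ
    E        : Fin n → Fin n → Bool
    A        : Fin n → Fin n → Bool
    E-sym    : ∀ x y → E x y ≡ E y x
    E-irrefl : ∀ x → E x x ≡ false
    A-irrefl : ∀ x → A x x ≡ false
    E-A-disj : ∀ x y → E x y ≡ true → A x y ≡ false

open MixedGraph public

_≅_ : MixedGraph → MixedGraph → Set
G ≅ H = Σ (Fin (n G) ↔ Fin (n H)) λ f →
          (∀ x y → E H (Inverse.to f x) (Inverse.to f y) ≡ E G x y) ×
          (∀ x y → A H (Inverse.to f x) (Inverse.to f y) ≡ A G x y)

emptyGraph : MixedGraph
emptyGraph = mkGraph 0 (λ ()) (λ ()) (λ ()) (λ ()) (λ ()) (λ ())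

-- The product G ↷ H : disjoint union plus all arcs from V(G) to V(H).
-- Vertices of G are the first n G elements of Fin (n G + n H).

module _ (G H : MixedGraph) where
  private
    m = n G
  E↷ : Fin (m +ℕ n H) → Fin (m +ℕ n H) → Bool
  E↷ i j with splitAt m i | splitAt m j
  ... | inj₁ a | inj₁ b = E G a b
  ... | inj₂ a | inj₂ b = E H a b
  ... | inj₁ _ | inj₂ _ = false
  ... | inj₂ _ | inj₁ _ = false

  A↷ : Fin (m +ℕ n H) → Fin (m +ℕ n H) → Bool
  A↷ i j with splitAt m i | splitAt m j
  ... | inj₁ a | inj₁ b = A G a b
  ... | inj₂ a | inj₂ b = A H a b
  ... | inj₁ _ | inj₂ _ = true
  ... | inj₂ _ | inj₁ _ = false

  E↷-sym : ∀ i j → E↷ i j ≡ E↷ j i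
  E↷-sym i j with splitAt m i | splitAt m j
  ... | inj₁ a | inj₁ b = E-sym G a b
  ... | inj₂ a | inj₂ b = E-sym H a b
  ... | inj₁ _ | inj₂ _ = refl
  ... | inj₂ _ | inj₁ _ = refl

  E↷-irrefl : ∀ i → E↷ i i ≡ false
  E↷-irrefl i with splitAt m i
  ... | inj₁ a = E-irrefl G a
  ... | inj₂ a = E-irrefl H a

  A↷-irrefl : ∀ i → A↷ i i ≡ false
  A↷-irrefl i with splitAt m i
  ... | inj₁ a = A-irrefl G a
  ... | inj₂ a = A-irrefl H a

  E↷-A↷-disj : ∀ i j → E↷ i j ≡ true → A↷ i j ≡ false
  E↷-A↷-disj i j with splitAt m i | splitAt m j
  ... | inj₁ a | inj₁ b = E-A-disj G a b
  ... | inj₂ a | inj₂ b = E-A-disj H a b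
  ... | inj₁ _ | inj₂ _ = λ ()
  ... | inj₂ _ | inj₁ _ = λ ()

infixl 7 _↷_
_↷_ : MixedGraph → MixedGraph → MixedGraph
G ↷ H = mkGraph (n G +ℕ n H) (E↷ G H) (A↷ G H) (E↷-sym G H)
          (E↷-irrefl G H) (A↷-irrefl G H) (E↷-A↷-disj G H)

size : ∀ {k} → Subset k → ℕ
size []          = 0
size (true ∷ s)  = suc (size s)
size (false ∷ s) = size s

emb : ∀ {k} (S : Subset k) → Fin (size S) → Fin k
emb (true ∷ s) zero    = zero
emb (true ∷ s) (suc i) = suc (emb s i)
emb (false ∷ s) i      = suc (emb s i)

induced : (G : MixedGraph) → Subset (n G) → MixedGraph
induced G S = mkGraph (size S)
  (λ i j → E G (emb S i) (emb S j))
  (λ i j → A G (emb S i) (emb S j))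
  (λ i j → E-sym G (emb S i) (emb S j))
  (λ i → E-irrefl G (emb S i))
  (λ i → A-irrefl G (emb S i))
  (λ i j → E-A-disj G (emb S i) (emb S j))

IsIdeal : (G : MixedGraph) → Subset (n G) → Set
IsIdeal G I = ∀ x y → x ∈ I → A G x y ≡ true → y ∈ I

isIdeal? : (G : MixedGraph) → Decidable (IsIdeal G)
isIdeal? G I = all? λ x → all? λ y →
  (x ∈? I) →-dec ((A G x y BoolP.≟ true) →-dec (y ∈? I))

allSubsets : (k : ℕ) → List (Subset k)
allSubsets zero    = [] ∷ []
allSubsets (suc k) = map (true ∷_) (allSubsets k) ++ map (false ∷_) (allSubsets k)

-- the list of all ideals of G (each subset exactly once)
ideals : (G : MixedGraph) → List (Subset (n G))
ideals G = filter (isIdeal? G) (allSubsets (n G))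

IsField : ∀ {c ℓ} → CommutativeRing c ℓ → Set (c ⊔ ℓ)
IsField R = (¬ (1# ≈ 0#)) × (∀ x → ¬ (x ≈ 0#) → ∃ λ y → (x * y) ≈ 1#)
  where open CommutativeRing R

-- Free R-module on the equivalence classes of a type B under _~_,
-- presented as formal finite sums (lists of coefficient/basis pairs)
-- modulo the relations of a free module.

module FreeModule {c ℓ} (R : CommutativeRing c ℓ) where
  open CommutativeRing R renaming (Carrier to K)

  FM : ∀ {b} → Set b → Set (c ⊔ b)
  FM B = List (K × B)

  data Equiv {b e} {B : Set b} (_~_ : B → B → Set e) : FM B → FM B → Set (c ⊔ ℓ ⊔ b ⊔ e) where
    ≡⇒≈    : ∀ {x y} → x ≡ y → Equiv _~_ x y
    ≈-sym   : ∀ {x y} → Equiv _~_ x y → Equiv _~_ y x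
    ≈-trans : ∀ {x y z} → Equiv _~_ x y → Equiv _~_ y z → Equiv _~_ x z
    ++-cong : ∀ {x x′ y y′} → Equiv _~_ x x′ → Equiv _~_ y y′ →
              Equiv _~_ (x ++ y) (x′ ++ y′)
    ++-swap : ∀ x y → Equiv _~_ (x ++ y) (y ++ x)
    merge   : ∀ a b g → Equiv _~_ ((a , g) ∷ (b , g) ∷ []) ((a + b , g) ∷ [])
    zero-coeff : ∀ g → Equiv _~_ ((0# , g) ∷ []) []
    coeff-cong : ∀ {a a′} g → a ≈ a′ → Equiv _~_ ((a , g) ∷ []) ((a′ , g) ∷ [])
    basis-cong : ∀ a {g g′} → g ~ g′ → Equiv _~_ ((a , g) ∷ []) ((a , g′) ∷ [])

  scale : ∀ {b} {B : Set b} → K → FM B → FM B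
  scale a = map λ { (c′ , g) → (a * c′ , g) }

  neg : ∀ {b} {B : Set b} → FM B → FM B
  neg = map λ { (c′ , g) → (- c′ , g) }

  bilin : ∀ {b₁ b₂ b₃} {B₁ : Set b₁} {B₂ : Set b₂} {B₃ : Set b₃} →
          (B₁ → B₂ → B₃) → FM B₁ → FM B₂ → FM B₃
  bilin f x y = concatMap (λ { (a , g) → map (λ { (b , h) → (a * b , f g h) }) y }) x

  lin : ∀ {b₁ b₂} {B₁ : Set b₁} {B₂ : Set b₂} → (B₁ → FM B₂) → FM B₁ → FM B₂
  lin f = concatMap λ { (a , g) → scale a (f g) }

module GraphBialgebra {c ℓ} (R : CommutativeRing c ℓ) where
  open CommutativeRing R renaming (Carrier to K)
  open FreeModule R public

  -- basis of F[G] ⊗ F[G] and F[G]⊗F[G]⊗F[G]: pairs / triples of graphs,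
  -- up to componentwise isomorphism
  _≅²_ : MixedGraph × MixedGraph → MixedGraph × MixedGraph → Set
  (G₁ , G₂) ≅² (H₁ , H₂) = (G₁ ≅ H₁) × (G₂ ≅ H₂)

  _≅³_ : MixedGraph × MixedGraph × MixedGraph → MixedGraph × MixedGraph × MixedGraph → Set
  (G₁ , G₂ , G₃) ≅³ (H₁ , H₂ , H₃) = (G₁ ≅ H₁) × (G₂ ≅ H₂) × (G₃ ≅ H₃)

  𝓕 : Set c
  𝓕 = FM MixedGraph

  𝓕⊗𝓕 : Set c
  𝓕⊗𝓕 = FM (MixedGraph × MixedGraph)

  𝓕⊗𝓕⊗𝓕 : Set c
  𝓕⊗𝓕⊗𝓕 = FM (MixedGraph × MixedGraph × MixedGraph)

  infix 4 _≈₁_ _≈₂_ _≈₃_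
  _≈₁_ : 𝓕 → 𝓕 → Set (c ⊔ ℓ)
  _≈₁_ = Equiv _≅_
  _≈₂_ : 𝓕⊗𝓕 → 𝓕⊗𝓕 → Set (c ⊔ ℓ)
  _≈₂_ = Equiv _≅²_
  _≈₃_ : 𝓕⊗𝓕⊗𝓕 → 𝓕⊗𝓕⊗𝓕 → Set (c ⊔ ℓ)
  _≈₃_ = Equiv _≅³_

  ⟦_⟧ : MixedGraph → 𝓕
  ⟦ G ⟧ = (1# , G) ∷ []

  𝟙 : 𝓕
  𝟙 = ⟦ emptyGraph ⟧

  infixl 7 _⋅_
  _⋅_ : 𝓕 → 𝓕 → 𝓕
  _⋅_ = bilin _↷_

  infixl 7 _⋅²_
  _⋅²_ : 𝓕⊗𝓕 → 𝓕⊗𝓕 → 𝓕⊗𝓕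
  _⋅²_ = bilin λ { (G₁ , G₂) (H₁ , H₂) → (G₁ ↷ H₁ , G₂ ↷ H₂) }

  infixr 6 _⊗_
  _⊗_ : 𝓕 → 𝓕 → 𝓕⊗𝓕
  _⊗_ = bilin _,_

  Δ₀ : MixedGraph → 𝓕⊗𝓕
  Δ₀ G = map (λ I → (1# , induced G (∁ I) , induced G I)) (ideals G)

  Δ : 𝓕 → 𝓕⊗𝓕
  Δ = lin Δ₀

  Δ⊗id : 𝓕⊗𝓕 → 𝓕⊗𝓕⊗𝓕
  Δ⊗id = lin λ { (G₁ , G₂) → map (λ { (a , H₁ , H₂) → (a , H₁ , H₂ , G₂) }) (Δ₀ G₁) }

  id⊗Δ : 𝓕⊗𝓕 → 𝓕⊗𝓕⊗𝓕
  id⊗Δ = lin λ { (G₁ , G₂) → map (λ { (a , H₁ , H₂) → (a , G₁ , H₁ , H₂) }) (Δ₀ G₂) }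

  ε₀ : MixedGraph → K
  ε₀ G with n G
  ... | zero  = 1#
  ... | suc _ = 0#

  -- ε ⊗ id  and  id ⊗ ε  (with K ⊗ F[G] ≅ F[G] ≅ F[G] ⊗ K)
  ε⊗id : 𝓕⊗𝓕 → 𝓕
  ε⊗id = map λ { (a , G₁ , G₂) → (a * ε₀ G₁ , G₂) }

  id⊗ε : 𝓕⊗𝓕 → 𝓕
  id⊗ε = map λ { (a , G₁ , G₂) → (a * ε₀ G₂ , G₁) }

{-# OPTIONS --safe #-}
-- Everything reduces to basis graphs, where it becomes a statement about
-- ideals. The product ↷ is associative and unital up to relabelling
-- vertices. The counit kills every term of Δ(G) except the one with I = V(G)
-- (resp. I = ∅). Both iterated coproducts of G are sums over the chains of
-- ideals I ⊆ L of G, because the ideals of G|L are the ideals of G inside L,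
-- and the ideals of G|V∖I are the L∖I for the ideals L ⊇ I.
-- Every vertex of G has an arc to every vertex of H, so an ideal of G ↷ H
-- either is ∅ ⊔ J with J an ideal of H, or I ⊔ V(H) with I ≠ ∅ an ideal of
-- G. These two families give (G ⊗ 1) ↷ Δ(H) and Δ(G) ↷ (1 ⊗ H), except that
-- ∅ ⊔ V(H) is counted in both, whence the term −G ⊗ H.

module Submission where

open import Defs
open import Level using (Level; 0ℓ; _⊔_)
open import Data.Bool using (Bool; true; false; not; if_then_else_) renaming (_≟_ to _≟ᴮ_)
open import Data.Nat using (zero; suc) renaming (_+_ to _+ℕ_)
open import Data.Fin using (Fin; zero; suc; splitAt; join; _↑ˡ_; _↑ʳ_)
open import Data.Fin.Subset using (Subset; ⊤; ⊥; ∁; _∈_; _∪_; _∩_; _⊆_; Nonempty)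
open import Data.Fin.Subset.Properties
  using ( _∈?_; nonempty?; Empty-unique; _⊆?_; in⊆in-⇔; out⊆-⇔; ∈⊤; ∉⊥; ⊆⊤; ⊆-antisym
        ; x∈p∪q⁺; x∈p∪q⁻; x∈∁p⇒x∉p; x∉p⇒x∈∁p)
open import Data.Fin.Properties using (+↔⊎; splitAt-join; splitAt⁻¹-↑ˡ; splitAt⁻¹-↑ʳ)
open import Data.Sum using (_⊎_; inj₁; inj₂; assocʳ; fromInj₁) renaming (map to map⊎)
open import Data.Sum.Algebra using (⊎-cong; ⊎-assoc)
open import Data.Product using (_×_; _,_; proj₁; proj₂; swap; ∃)
open import Data.Vec using ([]; _∷_; here; there) renaming (_++_ to _++ᵛ_)
open import Data.Vec.Properties
  using (≡-dec; ∷-injectiveˡ; ∷-injectiveʳ; lookup-++ˡ; lookup-++ʳ; []=⇒lookup; lookup⇒[]=)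
open import Data.List using (List; []; _∷_; _++_; map; concat; concatMap; filter; [_])
open import Data.List.Properties
  using ( map-id; map-∘; map-++; map-cong-local; ++-identityʳ; ++-assoc
        ; concatMap-cong; concatMap-pure; concatMap-map; map-concatMap; concatMap-++
        ; filter-accept; filter-none; filter-++; filter-≐)
open import Data.List.Relation.Unary.All using (All; []; _∷_)
import Data.List.Relation.Unary.All as All
open import Data.List.Relation.Unary.All.Properties using (all-filter)
open import Data.List.Relation.Binary.Permutation.Propositional
  using (_↭_; ↭-refl; ↭-sym; ↭-trans; ↭-reflexive; ↭-prep; module PermutationReasoning)
import Data.List.Relation.Binary.Permutation.Propositional as Perm
open import Data.List.Relation.Binary.Permutation.Propositional.Properties
  using (map⁺; ++⁺; ++⁺ˡ; ++⁺ʳ; ++-comm; shift)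
open import Function.Base using (id; case_of_)
open import Function.Bundles using (_↔_; Inverse; mk↔ₛ′; _⇔_; mk⇔; Equivalence)
open import Function.Properties.Inverse using (↔-refl; ↔-sym; ↔-trans)
open import Function.Properties.Equivalence using () renaming (sym to ⇔-sym)
open import Relation.Binary.Definitions using (DecidableEquality)
open import Relation.Binary.PropositionalEquality
  using (_≡_; _≢_; refl; sym; trans; cong; cong₂; module ≡-Reasoning)
open import Relation.Nullary using (Dec; yes; no; does; contradiction)
open import Relation.Nullary.Decidable using (_×-dec_; ¬?)
open import Relation.Unary using (Pred; Decidable)
open import Relation.Binary.Bundles using (Setoid)
import Relation.Binary.Reasoning.Setoid as ≈-Reasoning
open import Algebra.Bundles using (CommutativeRing)

open Inverse using (to; from; strictlyInverseˡ; strictlyInverseʳ)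

-- Lists

private variable
  a b c d p q : Level
  W X Y Z : Set a

filter-map : {P : Pred Y p} (P? : Decidable P) (f : X → Y) (xs : List X) →
             filter P? (map f xs) ≡ map f (filter (λ x → P? (f x)) xs)
filter-map P? f [] = refl
filter-map P? f (x ∷ xs) with does (P? (f x))
... | true  = cong (f x ∷_) (filter-map P? f xs)
... | false = filter-map P? f xs

map-map-map : (f : Y → Z) (g : X → Y) (h : W → X) (xs : List W) →
              map f (map g (map h xs)) ≡ map (λ x → f (g (h x))) xs
map-map-map f g h xs = sym (trans (map-∘ xs) (cong (map f) (map-∘ xs)))

filter-concatMap : {P : Pred Y p} (P? : Decidable P) (f : X → List Y) (xs : List X) →
                   filter P? (concatMap f xs) ≡ concatMap (λ x → filter P? (f x)) xs
filter-concatMap P? f [] = refl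
filter-concatMap P? f (x ∷ xs) =
  trans (filter-++ P? (f x) (concatMap f xs)) (cong (filter P? (f x) ++_) (filter-concatMap P? f xs))

filter-filter : {P : Pred X p} {Q : Pred X q} (P? : Decidable P) (Q? : Decidable Q) (xs : List X) →
                filter P? (filter Q? xs) ≡ filter (λ x → Q? x ×-dec P? x) xs
filter-filter P? Q? [] = refl
filter-filter P? Q? (x ∷ xs) with does (Q? x)
... | false = filter-filter P? Q? xs
... | true with does (P? x)
...   | true  = cong (x ∷_) (filter-filter P? Q? xs)
...   | false = filter-filter P? Q? xs

filter-comm : {P : Pred X p} {Q : Pred X q} (P? : Decidable P) (Q? : Decidable Q) (xs : List X) →
              filter P? (filter Q? xs) ≡ filter Q? (filter P? xs)
filter-comm P? Q? xs = begin
  filter P? (filter Q? xs)               ≡⟨ filter-filter P? Q? xs ⟩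
  filter (λ x → Q? x ×-dec P? x) xs      ≡⟨ filter-≐ _ _ (swap , swap) xs ⟩
  filter (λ x → P? x ×-dec Q? x) xs      ≡⟨ filter-filter Q? P? xs ⟨
  filter Q? (filter P? xs)               ∎
  where open ≡-Reasoning

filter-⇔ : {P : Pred X p} {Q : Pred X q} (P? : Decidable P) (Q? : Decidable Q) →
           (∀ {x} → Q x ⇔ P x) → (xs : List X) → filter P? xs ≡ filter Q? xs
filter-⇔ P? Q? Q⇔P = filter-≐ P? Q? (Equivalence.from Q⇔P , Equivalence.to Q⇔P)

map-filter-⇔ : {P : Pred Y p} {Q : Pred X q} (P? : Decidable P) (Q? : Decidable Q) (f : X → Y) →
               (∀ {x} → Q x ⇔ P (f x)) → (xs : List X) → map f (filter Q? xs) ≡ filter P? (map f xs)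
map-filter-⇔ P? Q? f Q⇔P xs = sym (trans (filter-map P? f xs) (cong (map f) (filter-⇔ _ Q? Q⇔P xs)))

partition-↭ : {P : Pred X p} (P? : Decidable P) (xs : List X) →
              xs ↭ filter P? xs ++ filter (λ x → ¬? (P? x)) xs
partition-↭ P? [] = ↭-refl
partition-↭ P? (x ∷ xs) with P? x
... | yes _ = ↭-prep x (partition-↭ P? xs)
... | no _  = ↭-trans (↭-prep x (partition-↭ P? xs)) (↭-sym (shift x (filter P? xs) _))

concatMap-↭ : (f : X → List Y) {xs ys : List X} → xs ↭ ys → concatMap f xs ↭ concatMap f ys
concatMap-↭ f Perm.refl = ↭-refl
concatMap-↭ f (Perm.prep x p) = ++⁺ˡ (f x) (concatMap-↭ f p)
concatMap-↭ f (Perm.swap x y p) =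
  ↭-trans (↭-reflexive (sym (++-assoc (f x) (f y) _)))
    (↭-trans (++⁺ (++-comm (f x) (f y)) (concatMap-↭ f p)) (↭-reflexive (++-assoc (f y) (f x) _)))
concatMap-↭ f (Perm.trans p q) = ↭-trans (concatMap-↭ f p) (concatMap-↭ f q)

concatMap-cong-↭ : {f g : X → List Y} (xs : List X) → (∀ x → f x ↭ g x) → concatMap f xs ↭ concatMap g xs
concatMap-cong-↭ []       f↭g = ↭-refl
concatMap-cong-↭ (x ∷ xs) f↭g = ++⁺ (f↭g x) (concatMap-cong-↭ xs f↭g)

concatMap-concatMap : (f : Y → List Z) (g : X → List Y) (xs : List X) →
                      concatMap f (concatMap g xs) ≡ concatMap (λ x → concatMap f (g x)) xs
concatMap-concatMap f g [] = refl
concatMap-concatMap f g (x ∷ xs) =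
  trans (concatMap-++ f (g x) (concatMap g xs)) (cong (concatMap f (g x) ++_) (concatMap-concatMap f g xs))

++-interchange-↭ : (ws xs ys zs : List X) → (ws ++ xs) ++ (ys ++ zs) ↭ (ws ++ ys) ++ (xs ++ zs)
++-interchange-↭ ws xs ys zs =
  ↭-trans (↭-reflexive (++-assoc ws xs (ys ++ zs)))
    (↭-trans (++⁺ˡ ws (↭-trans (↭-reflexive (sym (++-assoc xs ys zs)))
                        (↭-trans (++⁺ʳ zs (++-comm xs ys)) (↭-reflexive (++-assoc ys xs zs)))))
      (↭-reflexive (sym (++-assoc ws ys (xs ++ zs)))))

concatMap-++-↭ : (f g : X → List Y) (xs : List X) →
                 concatMap f xs ++ concatMap g xs ↭ concatMap (λ x → f x ++ g x) xs
concatMap-++-↭ f g [] = ↭-refl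
concatMap-++-↭ f g (x ∷ xs) =
  ↭-trans (++-interchange-↭ (f x) (concatMap f xs) (g x) (concatMap g xs))
    (++⁺ˡ (f x ++ g x) (concatMap-++-↭ f g xs))

concatMap-[] : (xs : List X) → concatMap (λ _ → [] {A = Y}) xs ≡ []
concatMap-[] [] = refl
concatMap-[] (x ∷ xs) = concatMap-[] xs

map≡concatMap : (f : X → Y) (xs : List X) → map f xs ≡ concatMap (λ x → [ f x ]) xs
map≡concatMap f [] = refl
map≡concatMap f (x ∷ xs) = cong (f x ∷_) (map≡concatMap f xs)

map-filter≡concatMap : {P : Pred X p} (P? : Decidable P) (f : X → Y) (xs : List X) →
  map f (filter P? xs) ≡ concatMap (λ x → if does (P? x) then [ f x ] else []) xs
map-filter≡concatMap P? f [] = refl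
map-filter≡concatMap P? f (x ∷ xs) with does (P? x)
... | true  = cong (f x ∷_) (map-filter≡concatMap P? f xs)
... | false = map-filter≡concatMap P? f xs

concatMap-comm : (g : X → Y → List Z) (xs : List X) (ys : List Y) →
  concatMap (λ x → concatMap (g x) ys) xs ↭ concatMap (λ y → concatMap (λ x → g x y) xs) ys
concatMap-comm g [] ys = ↭-reflexive (sym (concatMap-[] ys))
concatMap-comm g (x ∷ xs) ys =
  ↭-trans (++⁺ˡ (concatMap (g x) ys) (concatMap-comm g xs ys))
          (concatMap-++-↭ (g x) (λ y → concatMap (λ x → g x y) xs) ys)

concatMap-map-comm : (f : X → Y → Z) (xs : List X) (ys : List Y) →
  concatMap (λ x → map (f x) ys) xs ↭ concatMap (λ y → map (λ x → f x y) xs) ys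
concatMap-map-comm f xs ys =
  ↭-trans (↭-reflexive (concatMap-cong (λ x → map≡concatMap (f x) ys) xs))
    (↭-trans (concatMap-comm (λ x y → [ f x y ]) xs ys)
      (↭-reflexive (sym (concatMap-cong (λ y → map≡concatMap (λ x → f x y) xs) ys))))

concatMap-filter-comm : {R : X → Y → Set p} (R? : ∀ x y → Dec (R x y)) (f : X → Y → Z) (xs : List X) (ys : List Y) →
  concatMap (λ x → map (f x) (filter (R? x) ys)) xs ↭
  concatMap (λ y → map (λ x → f x y) (filter (λ x → R? x y) xs)) ys
concatMap-filter-comm R? f xs ys =
  ↭-trans (↭-reflexive (concatMap-cong (λ x → map-filter≡concatMap (R? x) (f x) ys) xs))
    (↭-trans (concatMap-comm (λ x y → if does (R? x y) then [ f x y ] else []) xs ys)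
      (↭-reflexive (sym (concatMap-cong (λ y → map-filter≡concatMap (λ x → R? x y) (λ x → f x y) xs) ys))))

-- Isomorphisms of mixed graphs

-- _≅_ unfolds to a Σ-type from which Agda cannot recover the two graphs;
-- wrapping it in a record makes them inferable.
infix 4 _≃_
record _≃_ (G H : MixedGraph) : Set where
  constructor mk≃
  field ≅ : G ≅ H
open _≃_ public

≃-via : ∀ {G H} {T : Set} (φ : T ↔ Fin (n G)) (ψ : T ↔ Fin (n H)) →
        (∀ t u → E G (to φ t) (to φ u) ≡ E H (to ψ t) (to ψ u)) →
        (∀ t u → A G (to φ t) (to φ u) ≡ A H (to ψ t) (to ψ u)) →
        G ≃ H
≃-via {G} {H} φ ψ e a = mk≃ (↔-trans (↔-sym φ) ψ , preserves (E G) (E H) e , preserves (A G) (A H) a)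
  where
  preserves : (R : Fin (n G) → Fin (n G) → Bool) (S : Fin (n H) → Fin (n H) → Bool) →
              (∀ t u → R (to φ t) (to φ u) ≡ S (to ψ t) (to ψ u)) →
              ∀ x y → S (to ψ (from φ x)) (to ψ (from φ y)) ≡ R x y
  preserves R S r x y = trans (sym (r (from φ x) (from φ y)))
                              (cong₂ R (strictlyInverseˡ φ x) (strictlyInverseˡ φ y))

≃-refl : ∀ {G} → G ≃ G
≃-refl = mk≃ (↔-refl , (λ _ _ → refl) , (λ _ _ → refl))

≃-trans : ∀ {G H K} → G ≃ H → H ≃ K → G ≃ K
≃-trans (mk≃ (f , e , a)) (mk≃ (g , e′ , a′)) =
  ≃-via ↔-refl (↔-trans f g) (λ x y → sym (trans (e′ _ _) (e x y))) (λ x y → sym (trans (a′ _ _) (a x y)))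

≡⇒≃ : ∀ {G H} → G ≡ H → G ≃ H
≡⇒≃ refl = ≃-refl

≃-emptyGraph : ∀ G → n G ≡ 0 → G ≃ emptyGraph
≃-emptyGraph (mkGraph .0 _ _ _ _ _ _) refl = mk≃ (↔-refl , (λ ()) , (λ ()))

module ≃-Reasoning where
  infix  1 begin_
  infixr 2 _≃⟨_⟩_ _≡⟨_⟩_
  infix  3 _∎

  begin_ : ∀ {G H} → G ≃ H → G ≃ H
  begin p = p

  _≃⟨_⟩_ : ∀ G {H K} → G ≃ H → H ≃ K → G ≃ K
  G ≃⟨ p ⟩ q = ≃-trans p q

  _≡⟨_⟩_ : ∀ G {H K} → G ≡ H → H ≃ K → G ≃ K
  G ≡⟨ refl ⟩ q = q

  _∎ : ∀ G → G ≃ G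
  G ∎ = ≃-refl

-- The product ↷

-- The edge or arc relation of a product, on the disjoint union of the
-- vertex sets; `across` is its value from the first factor to the second.
sumRel : ∀ {X Y : Set} → (X → X → Bool) → (Y → Y → Bool) → (across : Bool) →
         X ⊎ Y → X ⊎ Y → Bool
sumRel R S c (inj₁ x) (inj₁ y) = R x y
sumRel R S c (inj₂ x) (inj₂ y) = S x y
sumRel R S c (inj₁ _) (inj₂ _) = c
sumRel R S c (inj₂ _) (inj₁ _) = false

sumRel-map : ∀ {X X′ Y Y′ : Set} {R : X → X → Bool} {R′ : X′ → X′ → Bool}
             {S : Y → Y → Bool} {S′ : Y′ → Y′ → Bool} {c} {f : X → X′} {g : Y → Y′} →
             (∀ x y → R′ (f x) (f y) ≡ R x y) → (∀ x y → S′ (g x) (g y) ≡ S x y) →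
             ∀ u v → sumRel R′ S′ c (map⊎ f g u) (map⊎ f g v) ≡ sumRel R S c u v
sumRel-map r s (inj₁ x) (inj₁ y) = r x y
sumRel-map r s (inj₁ x) (inj₂ y) = refl
sumRel-map r s (inj₂ x) (inj₁ y) = refl
sumRel-map r s (inj₂ x) (inj₂ y) = s x y

sumRel-assoc : ∀ {X Y Z : Set} (R : X → X → Bool) (S : Y → Y → Bool) (T : Z → Z → Bool) c u v →
               sumRel R (sumRel S T c) c (assocʳ u) (assocʳ v) ≡ sumRel (sumRel R S c) T c u v
sumRel-assoc R S T c (inj₁ (inj₁ x)) (inj₁ (inj₁ y)) = refl
sumRel-assoc R S T c (inj₁ (inj₁ x)) (inj₁ (inj₂ y)) = refl
sumRel-assoc R S T c (inj₁ (inj₁ x)) (inj₂ y)        = refl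
sumRel-assoc R S T c (inj₁ (inj₂ x)) (inj₁ (inj₁ y)) = refl
sumRel-assoc R S T c (inj₁ (inj₂ x)) (inj₁ (inj₂ y)) = refl
sumRel-assoc R S T c (inj₁ (inj₂ x)) (inj₂ y)        = refl
sumRel-assoc R S T c (inj₂ x)        (inj₁ (inj₁ y)) = refl
sumRel-assoc R S T c (inj₂ x)        (inj₁ (inj₂ y)) = refl
sumRel-assoc R S T c (inj₂ x)        (inj₂ y)        = refl

E-↷-join : ∀ G H u v → E (G ↷ H) (join (n G) (n H) u) (join (n G) (n H) v) ≡ sumRel (E G) (E H) false u v
E-↷-join G H u v rewrite splitAt-join (n G) (n H) u | splitAt-join (n G) (n H) v with u | v
... | inj₁ x | inj₁ y = refl
... | inj₁ x | inj₂ y = refl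
... | inj₂ x | inj₁ y = refl
... | inj₂ x | inj₂ y = refl

A-↷-join : ∀ G H u v → A (G ↷ H) (join (n G) (n H) u) (join (n G) (n H) v) ≡ sumRel (A G) (A H) true u v
A-↷-join G H u v rewrite splitAt-join (n G) (n H) u | splitAt-join (n G) (n H) v with u | v
... | inj₁ x | inj₁ y = refl
... | inj₁ x | inj₂ y = refl
... | inj₂ x | inj₁ y = refl
... | inj₂ x | inj₂ y = refl

module ProductRelation
  (rel : (G : MixedGraph) → Fin (n G) → Fin (n G) → Bool) (across : Bool)
  (rel-↷-join : ∀ G H u v → rel (G ↷ H) (join (n G) (n H) u) (join (n G) (n H) v) ≡
                             sumRel (rel G) (rel H) across u v)
  where

  rel-↷-join-map : ∀ {G G′ H H′} {f : Fin (n G) → Fin (n G′)} {g : Fin (n H) → Fin (n H′)} →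
    (∀ x y → rel G′ (f x) (f y) ≡ rel G x y) → (∀ x y → rel H′ (g x) (g y) ≡ rel H x y) →
    ∀ u v → rel (G′ ↷ H′) (join (n G′) (n H′) (map⊎ f g u)) (join (n G′) (n H′) (map⊎ f g v)) ≡
            rel (G ↷ H) (join (n G) (n H) u) (join (n G) (n H) v)
  rel-↷-join-map {G} {G′} {H} {H′} {f} {g} r s u v =
    trans (rel-↷-join G′ H′ (map⊎ f g u) (map⊎ f g v))
          (trans (sumRel-map {R′ = rel G′} {S′ = rel H′} r s u v) (sym (rel-↷-join G H u v)))

  rel-↷-assoc : ∀ G H L (t u : (Fin (n G) ⊎ Fin (n H)) ⊎ Fin (n L)) →
    let φ t = join (n G +ℕ n H) (n L) (map⊎ (join (n G) (n H)) id t)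
        ψ t = join (n G) (n H +ℕ n L) (map⊎ id (join (n H) (n L)) (assocʳ t))
    in rel ((G ↷ H) ↷ L) (φ t) (φ u) ≡ rel (G ↷ (H ↷ L)) (ψ t) (ψ u)
  rel-↷-assoc G H L t u = begin
    rel ((G ↷ H) ↷ L) (join _ _ (φ t)) (join _ _ (φ u))
      ≡⟨ rel-↷-join (G ↷ H) L (φ t) (φ u) ⟩
    sumRel (rel (G ↷ H)) (rel L) across (φ t) (φ u)
      ≡⟨ sumRel-map (rel-↷-join G H) (λ _ _ → refl) t u ⟩
    sumRel (sumRel (rel G) (rel H) across) (rel L) across t u
      ≡⟨ sym (sumRel-assoc (rel G) (rel H) (rel L) across t u) ⟩
    sumRel (rel G) (sumRel (rel H) (rel L) across) across (assocʳ t) (assocʳ u)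
      ≡⟨ sym (sumRel-map (λ _ _ → refl) (rel-↷-join H L) (assocʳ t) (assocʳ u)) ⟩
    sumRel (rel G) (rel (H ↷ L)) across (ψ t) (ψ u)
      ≡⟨ sym (rel-↷-join G (H ↷ L) (ψ t) (ψ u)) ⟩
    rel (G ↷ (H ↷ L)) (join _ _ (ψ t)) (join _ _ (ψ u)) ∎
    where
    open ≡-Reasoning
    φ : (Fin (n G) ⊎ Fin (n H)) ⊎ Fin (n L) → Fin (n G +ℕ n H) ⊎ Fin (n L)
    φ = map⊎ (join (n G) (n H)) id
    ψ : (Fin (n G) ⊎ Fin (n H)) ⊎ Fin (n L) → Fin (n G) ⊎ Fin (n H +ℕ n L)
    ψ t = map⊎ id (join (n H) (n L)) (assocʳ t)

module Edges = ProductRelation E false E-↷-join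
module Arcs  = ProductRelation A true  A-↷-join

↷-cong : ∀ {G G′ H H′} → G ≃ G′ → H ≃ H′ → G ↷ H ≃ G′ ↷ H′
↷-cong {G} {G′} {H} {H′} (mk≃ (f , ef , af)) (mk≃ (g , eg , ag)) =
  ≃-via (↔-sym +↔⊎) (↔-trans (⊎-cong f g) (↔-sym +↔⊎))
    (λ u v → sym (Edges.rel-↷-join-map {G} {G′} {H} {H′} ef eg u v))
    (λ u v → sym (Arcs.rel-↷-join-map {G} {G′} {H} {H′} af ag u v))

↷-identityˡ : ∀ H → emptyGraph ↷ H ≃ H
↷-identityˡ H = ≃-refl

↷-identityʳ : ∀ G → G ↷ emptyGraph ≃ G
↷-identityʳ G = ≃-via (↔-trans inj₁-↔ (↔-sym +↔⊎)) ↔-refl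
  (λ x y → E-↷-join G emptyGraph (inj₁ x) (inj₁ y)) (λ x y → A-↷-join G emptyGraph (inj₁ x) (inj₁ y))
  where
  inj₁-↔ : Fin (n G) ↔ (Fin (n G) ⊎ Fin 0)
  inj₁-↔ = mk↔ₛ′ inj₁ (fromInj₁ (λ ())) (λ { (inj₁ x) → refl ; (inj₂ ()) }) (λ _ → refl)

↷-assoc : ∀ G H L → (G ↷ H) ↷ L ≃ G ↷ (H ↷ L)
↷-assoc G H L =
  ≃-via (↔-trans (⊎-cong (↔-sym +↔⊎) ↔-refl) (↔-sym +↔⊎))
        (↔-trans (⊎-assoc 0ℓ _ _ _) (↔-trans (⊎-cong ↔-refl (↔-sym +↔⊎)) (↔-sym +↔⊎)))
        (Edges.rel-↷-assoc G H L) (Arcs.rel-↷-assoc G H L)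

-- Subsets

∁-⊥ : ∀ k → ∁ (⊥ {k}) ≡ ⊤
∁-⊥ zero    = refl
∁-⊥ (suc k) = cong (true ∷_) (∁-⊥ k)

∁-⊤ : ∀ k → ∁ (⊤ {k}) ≡ ⊥
∁-⊤ zero    = refl
∁-⊤ (suc k) = cong (false ∷_) (∁-⊤ k)

∁-++ : ∀ {m k} (S : Subset m) (T : Subset k) → ∁ (S ++ᵛ T) ≡ ∁ S ++ᵛ ∁ T
∁-++ []      T = refl
∁-++ (b ∷ S) T = cong (not b ∷_) (∁-++ S T)

size-⊥ : ∀ k → size (⊥ {k}) ≡ 0
size-⊥ zero    = refl
size-⊥ (suc k) = size-⊥ k

size≡0⇒≡⊥ : ∀ {k} (S : Subset k) → size S ≡ 0 → S ≡ ⊥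
size≡0⇒≡⊥ []          _ = refl
size≡0⇒≡⊥ (false ∷ S) e = cong (false ∷_) (size≡0⇒≡⊥ S e)

size-∁≡0⇒≡⊤ : ∀ {k} (S : Subset k) → size (∁ S) ≡ 0 → S ≡ ⊤
size-∁≡0⇒≡⊤ []         _ = refl
size-∁≡0⇒≡⊤ (true ∷ S) e = cong (true ∷_) (size-∁≡0⇒≡⊤ S e)

≢⊥⇒nonempty : ∀ {k} (S : Subset k) → S ≢ ⊥ → Nonempty S
≢⊥⇒nonempty S S≢⊥ with nonempty? S
... | yes ne = ne
... | no  ¬ne = contradiction (Empty-unique ¬ne) S≢⊥

∈-↑ˡ-++⁺ : ∀ {m k} (S : Subset m) (T : Subset k) {x} → x ∈ S → (x ↑ˡ k) ∈ S ++ᵛ T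
∈-↑ˡ-++⁺ S T x∈S = lookup⇒[]= _ (S ++ᵛ T) (trans (lookup-++ˡ S T _) ([]=⇒lookup x∈S))

∈-↑ˡ-++⁻ : ∀ {m k} (S : Subset m) (T : Subset k) {x} → (x ↑ˡ k) ∈ S ++ᵛ T → x ∈ S
∈-↑ˡ-++⁻ S T x∈ = lookup⇒[]= _ S (trans (sym (lookup-++ˡ S T _)) ([]=⇒lookup x∈))

∈-↑ʳ-++⁺ : ∀ {m k} (S : Subset m) (T : Subset k) {y} → y ∈ T → (m ↑ʳ y) ∈ S ++ᵛ T
∈-↑ʳ-++⁺ S T y∈T = lookup⇒[]= _ (S ++ᵛ T) (trans (lookup-++ʳ S T _) ([]=⇒lookup y∈T))

∈-↑ʳ-++⁻ : ∀ {m k} (S : Subset m) (T : Subset k) {y} → (m ↑ʳ y) ∈ S ++ᵛ T → y ∈ T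
∈-↑ʳ-++⁻ S T y∈ = lookup⇒[]= _ T (trans (sym (lookup-++ʳ S T _)) ([]=⇒lookup y∈))

emb-∈ : ∀ {k} (S : Subset k) i → emb S i ∈ S
emb-∈ (true ∷ S)  zero    = here
emb-∈ (true ∷ S)  (suc i) = there (emb-∈ S i)
emb-∈ (false ∷ S) i       = there (emb-∈ S i)

∈⇒emb : ∀ {k} (S : Subset k) {x} → x ∈ S → ∃ λ i → emb S i ≡ x
∈⇒emb (true ∷ S)  here      = zero , refl
∈⇒emb (true ∷ S)  (there p) = let i , e = ∈⇒emb S p in suc i , cong suc e
∈⇒emb (false ∷ S) (there p) = let i , e = ∈⇒emb S p in i , cong suc e

emb-⊤-↔ : ∀ k → Fin (size (⊤ {k})) ↔ Fin k
emb-⊤-↔ k = mk↔ₛ′ (emb (⊤ {k})) from-⊤ emb-from-⊤ from-emb-⊤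
  where
  from-⊤ : ∀ {k} → Fin k → Fin (size (⊤ {k}))
  from-⊤ zero    = zero
  from-⊤ (suc i) = suc (from-⊤ i)
  emb-from-⊤ : ∀ {k} (x : Fin k) → emb ⊤ (from-⊤ x) ≡ x
  emb-from-⊤ zero    = refl
  emb-from-⊤ (suc x) = cong suc (emb-from-⊤ x)
  from-emb-⊤ : ∀ {k} (i : Fin (size (⊤ {k}))) → from-⊤ (emb (⊤ {k}) i) ≡ i
  from-emb-⊤ {suc k} zero    = refl
  from-emb-⊤ {suc k} (suc i) = cong suc (from-emb-⊤ {k} i)

-- The image of a subset J of Fin (size S) under the enumeration emb S.
embSubset : ∀ {k} (S : Subset k) → Subset (size S) → Subset k
embSubset []          []      = []
embSubset (true ∷ S)  (b ∷ J) = b ∷ embSubset S J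
embSubset (false ∷ S) J       = false ∷ embSubset S J

embSubset-↔ : ∀ {k} (S : Subset k) (J : Subset (size S)) → Fin (size J) ↔ Fin (size (embSubset S J))
embSubset-↔ S J = mk↔ₛ′ (φ S J) (ψ S J) (φψ S J) (ψφ S J)
  where
  φ : ∀ {k} (S : Subset k) (J : Subset (size S)) → Fin (size J) → Fin (size (embSubset S J))
  φ []          []          ()
  φ (true ∷ S)  (true ∷ J)  zero    = zero
  φ (true ∷ S)  (true ∷ J)  (suc i) = suc (φ S J i)
  φ (true ∷ S)  (false ∷ J) i       = φ S J i
  φ (false ∷ S) J           i       = φ S J i
  ψ : ∀ {k} (S : Subset k) (J : Subset (size S)) → Fin (size (embSubset S J)) → Fin (size J)
  ψ []          []          ()
  ψ (true ∷ S)  (true ∷ J)  zero    = zero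
  ψ (true ∷ S)  (true ∷ J)  (suc i) = suc (ψ S J i)
  ψ (true ∷ S)  (false ∷ J) i       = ψ S J i
  ψ (false ∷ S) J           i       = ψ S J i
  φψ : ∀ {k} (S : Subset k) (J : Subset (size S)) i → φ S J (ψ S J i) ≡ i
  φψ []          []          ()
  φψ (true ∷ S)  (true ∷ J)  zero    = refl
  φψ (true ∷ S)  (true ∷ J)  (suc i) = cong suc (φψ S J i)
  φψ (true ∷ S)  (false ∷ J) i       = φψ S J i
  φψ (false ∷ S) J           i       = φψ S J i
  ψφ : ∀ {k} (S : Subset k) (J : Subset (size S)) i → ψ S J (φ S J i) ≡ i
  ψφ []          []          ()
  ψφ (true ∷ S)  (true ∷ J)  zero    = refl
  ψφ (true ∷ S)  (true ∷ J)  (suc i) = cong suc (ψφ S J i)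
  ψφ (true ∷ S)  (false ∷ J) i       = ψφ S J i
  ψφ (false ∷ S) J           i       = ψφ S J i

emb-embSubset : ∀ {k} (S : Subset k) (J : Subset (size S)) i →
                emb (embSubset S J) (to (embSubset-↔ S J) i) ≡ emb S (emb J i)
emb-embSubset []          []          ()
emb-embSubset (true ∷ S)  (true ∷ J)  zero    = refl
emb-embSubset (true ∷ S)  (true ∷ J)  (suc i) = cong suc (emb-embSubset S J i)
emb-embSubset (true ∷ S)  (false ∷ J) i       = cong suc (emb-embSubset S J i)
emb-embSubset (false ∷ S) J           i       = cong suc (emb-embSubset S J i)

∈-embSubset⁺ : ∀ {k} (S : Subset k) (J : Subset (size S)) {i} → i ∈ J → emb S i ∈ embSubset S J
∈-embSubset⁺ (true ∷ S)  (b ∷ J) {zero}  here      = here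
∈-embSubset⁺ (true ∷ S)  (b ∷ J) {suc i} (there p) = there (∈-embSubset⁺ S J p)
∈-embSubset⁺ (false ∷ S) J               p         = there (∈-embSubset⁺ S J p)

∈-embSubset⁻ : ∀ {k} (S : Subset k) (J : Subset (size S)) i → emb S i ∈ embSubset S J → i ∈ J
∈-embSubset⁻ (true ∷ S)  (b ∷ J) zero    here      = here
∈-embSubset⁻ (true ∷ S)  (b ∷ J) (suc i) (there p) = there (∈-embSubset⁻ S J i p)
∈-embSubset⁻ (false ∷ S) J       i       (there p) = ∈-embSubset⁻ S J i p

embSubset-⊆ : ∀ {k} (S : Subset k) (J : Subset (size S)) → embSubset S J ⊆ S
embSubset-⊆ (true ∷ S)  (b ∷ J) here      = here
embSubset-⊆ (true ∷ S)  (b ∷ J) (there p) = there (embSubset-⊆ S J p)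
embSubset-⊆ (false ∷ S) J       (there p) = there (embSubset-⊆ S J p)

embSubset-∁ : ∀ {k} (S : Subset k) (J : Subset (size S)) → embSubset S (∁ J) ≡ S ∩ ∁ (embSubset S J)
embSubset-∁ []          []      = refl
embSubset-∁ (true ∷ S)  (b ∷ J) = cong (not b ∷_) (embSubset-∁ S J)
embSubset-∁ (false ∷ S) J       = cong (false ∷_) (embSubset-∁ S J)

-- The supersets of I correspond to the subsets J of its complement.
superset : ∀ {k} (I : Subset k) → Subset (size (∁ I)) → Subset k
superset I J = I ∪ embSubset (∁ I) J

∁-superset : ∀ {k} (I : Subset k) J → ∁ (superset I J) ≡ embSubset (∁ I) (∁ J)
∁-superset []          []      = refl
∁-superset (true ∷ I)  J       = cong (false ∷_) (∁-superset I J)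
∁-superset (false ∷ I) (b ∷ J) = cong (not b ∷_) (∁-superset I J)

superset-∩-∁ : ∀ {k} (I : Subset k) J → superset I J ∩ ∁ I ≡ embSubset (∁ I) J
superset-∩-∁ []          []          = refl
superset-∩-∁ (true ∷ I)  J           = cong (false ∷_) (superset-∩-∁ I J)
superset-∩-∁ (false ∷ I) (true ∷ J)  = cong (true ∷_) (superset-∩-∁ I J)
superset-∩-∁ (false ∷ I) (false ∷ J) = cong (false ∷_) (superset-∩-∁ I J)

++-↔ : ∀ {m k} (S : Subset m) (T : Subset k) → (Fin (size S) ⊎ Fin (size T)) ↔ Fin (size (S ++ᵛ T))
++-↔ S T = mk↔ₛ′ (joinS S T) (splitS S T) (joinS-splitS S T) (splitS-joinS S T)
  where
  joinS : ∀ {m k} (S : Subset m) (T : Subset k) → Fin (size S) ⊎ Fin (size T) → Fin (size (S ++ᵛ T))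
  joinS []          T (inj₂ i)       = i
  joinS (true ∷ S)  T (inj₁ zero)    = zero
  joinS (true ∷ S)  T (inj₁ (suc x)) = suc (joinS S T (inj₁ x))
  joinS (true ∷ S)  T (inj₂ y)       = suc (joinS S T (inj₂ y))
  joinS (false ∷ S) T u              = joinS S T u
  splitS : ∀ {m k} (S : Subset m) (T : Subset k) → Fin (size (S ++ᵛ T)) → Fin (size S) ⊎ Fin (size T)
  splitS []          T i       = inj₂ i
  splitS (true ∷ S)  T zero    = inj₁ zero
  splitS (true ∷ S)  T (suc i) = map⊎ suc id (splitS S T i)
  splitS (false ∷ S) T i       = splitS S T i
  splitS-joinS : ∀ {m k} (S : Subset m) (T : Subset k) u → splitS S T (joinS S T u) ≡ u
  splitS-joinS []          T (inj₂ i)       = refl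
  splitS-joinS (true ∷ S)  T (inj₁ zero)    = refl
  splitS-joinS (true ∷ S)  T (inj₁ (suc x)) = cong (map⊎ suc id) (splitS-joinS S T (inj₁ x))
  splitS-joinS (true ∷ S)  T (inj₂ y)       = cong (map⊎ suc id) (splitS-joinS S T (inj₂ y))
  splitS-joinS (false ∷ S) T u              = splitS-joinS S T u
  joinS-suc : ∀ {m k} (S : Subset m) (T : Subset k) u →
              joinS (true ∷ S) T (map⊎ suc id u) ≡ suc (joinS S T u)
  joinS-suc S T (inj₁ x) = refl
  joinS-suc S T (inj₂ y) = refl
  joinS-splitS : ∀ {m k} (S : Subset m) (T : Subset k) i → joinS S T (splitS S T i) ≡ i
  joinS-splitS []          T i       = refl
  joinS-splitS (true ∷ S)  T zero    = refl
  joinS-splitS (true ∷ S)  T (suc i) = trans (joinS-suc S T (splitS S T i)) (cong suc (joinS-splitS S T i))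
  joinS-splitS (false ∷ S) T i       = joinS-splitS S T i

emb-++ : ∀ {m k} (S : Subset m) (T : Subset k) u →
         emb (S ++ᵛ T) (to (++-↔ S T) u) ≡ join m k (map⊎ (emb S) (emb T) u)
emb-++ []          T (inj₂ y)       = refl
emb-++ (true ∷ S)  T (inj₁ zero)    = refl
emb-++ (true ∷ S)  T (inj₁ (suc x)) = cong suc (emb-++ S T (inj₁ x))
emb-++ (true ∷ S)  T (inj₂ y)       = cong suc (emb-++ S T (inj₂ y))
emb-++ (false ∷ S) T (inj₁ x)       = cong suc (emb-++ S T (inj₁ x))
emb-++ (false ∷ S) T (inj₂ y)       = cong suc (emb-++ S T (inj₂ y))

infix 4 _≟ˢ_
_≟ˢ_ : ∀ {k} → DecidableEquality (Subset k)
_≟ˢ_ = ≡-dec _≟ᴮ_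

filter-allSubsets-suc : ∀ {k} {P : Pred (Subset (suc k)) p} (P? : Decidable P) →
  filter P? (allSubsets (suc k)) ≡
  map (true ∷_) (filter (λ S → P? (true ∷ S)) (allSubsets k)) ++
  map (false ∷_) (filter (λ S → P? (false ∷ S)) (allSubsets k))
filter-allSubsets-suc {k = k} P? =
  trans (filter-++ P? (map (true ∷_) (allSubsets k)) (map (false ∷_) (allSubsets k)))
        (cong₂ _++_ (filter-map P? (true ∷_) (allSubsets k)) (filter-map P? (false ∷_) (allSubsets k)))

filter-≟-allSubsets : ∀ k (S : Subset k) → filter (_≟ˢ S) (allSubsets k) ≡ [ S ]
filter-≟-allSubsets zero    [] = refl
filter-≟-allSubsets (suc k) (b ∷ S) = begin
  filter (_≟ˢ (b ∷ S)) (allSubsets (suc k))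
    ≡⟨ filter-allSubsets-suc (_≟ˢ (b ∷ S)) ⟩
  map (true ∷_) (filter (λ T → (true ∷ T) ≟ˢ (b ∷ S)) (allSubsets k)) ++
  map (false ∷_) (filter (λ T → (false ∷ T) ≟ˢ (b ∷ S)) (allSubsets k))
    ≡⟨ cong₂ (λ xs ys → map (true ∷_) xs ++ map (false ∷_) ys) (filter-∷ true) (filter-∷ false) ⟩
  map (true ∷_) (if does (true ≟ᴮ b) then [ S ] else []) ++
  map (false ∷_) (if does (false ≟ᴮ b) then [ S ] else [])
    ≡⟨ halves b ⟩
  [ b ∷ S ] ∎
  where
  open ≡-Reasoning
  filter-∷ : ∀ c → filter (λ T → (c ∷ T) ≟ˢ (b ∷ S)) (allSubsets k) ≡ (if does (c ≟ᴮ b) then [ S ] else [])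
  filter-∷ c with c ≟ᴮ b
  ... | yes refl = trans (filter-≐ _ (_≟ˢ S) (∷-injectiveʳ , cong (c ∷_)) (allSubsets k)) (filter-≟-allSubsets k S)
  ... | no c≢b   = filter-none _ (All.universal (λ T e → c≢b (∷-injectiveˡ e)) (allSubsets k))
  halves : ∀ b → map (true ∷_) (if does (true ≟ᴮ b) then [ S ] else []) ++
                   map (false ∷_) (if does (false ≟ᴮ b) then [ S ] else []) ≡ [ b ∷ S ]
  halves true  = refl
  halves false = refl

allSubsets-+ : ∀ m k → allSubsets (m +ℕ k) ≡ concatMap (λ S → map (S ++ᵛ_) (allSubsets k)) (allSubsets m)
allSubsets-+ zero    k = sym (trans (++-identityʳ _) (map-id (allSubsets k)))
allSubsets-+ (suc m) k = begin
  map (true ∷_) (allSubsets (m +ℕ k)) ++ map (false ∷_) (allSubsets (m +ℕ k))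
    ≡⟨ cong₂ _++_ (prefix true) (prefix false) ⟩
  concatMap F (map (true ∷_) (allSubsets m)) ++ concatMap F (map (false ∷_) (allSubsets m))
    ≡⟨ concatMap-++ F (map (true ∷_) (allSubsets m)) (map (false ∷_) (allSubsets m)) ⟨
  concatMap F (allSubsets (suc m)) ∎
  where
  open ≡-Reasoning
  F : ∀ {m} → Subset m → List (Subset (m +ℕ k))
  F S = map (S ++ᵛ_) (allSubsets k)
  prefix : ∀ b → map (b ∷_) (allSubsets (m +ℕ k)) ≡ concatMap F (map (b ∷_) (allSubsets m))
  prefix b = begin
    map (b ∷_) (allSubsets (m +ℕ k))                             ≡⟨ cong (map (b ∷_)) (allSubsets-+ m k) ⟩
    map (b ∷_) (concatMap F (allSubsets m))                      ≡⟨ map-concatMap (b ∷_) F (allSubsets m) ⟩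
    concatMap (λ S → map (b ∷_) (F S)) (allSubsets m)
      ≡⟨ concatMap-cong (λ S → map-∘ (allSubsets k)) (allSubsets m) ⟨
    concatMap (λ S → F (b ∷ S)) (allSubsets m)                   ≡⟨ concatMap-map F (b ∷_) (allSubsets m) ⟨
    concatMap F (map (b ∷_) (allSubsets m))                      ∎

map-superset-allSubsets : ∀ {k} (I : Subset k) →
  map (superset I) (allSubsets (size (∁ I))) ≡ filter (I ⊆?_) (allSubsets k)
map-superset-allSubsets []          = refl
map-superset-allSubsets {suc k} (true ∷ I) = begin
  map (superset (true ∷ I)) (allSubsets (size (∁ I)))
    ≡⟨ map-∘ (allSubsets (size (∁ I))) ⟩
  map (true ∷_) (map (superset I) (allSubsets (size (∁ I))))
    ≡⟨ cong (map (true ∷_)) (map-superset-allSubsets I) ⟩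
  map (true ∷_) (filter (I ⊆?_) (allSubsets k))
    ≡⟨ ++-identityʳ _ ⟨
  map (true ∷_) (filter (I ⊆?_) (allSubsets k)) ++ map (false ∷_) []
    ≡⟨ cong₂ (λ xs ys → map (true ∷_) xs ++ map (false ∷_) ys)
             (filter-⇔ _ _ in⊆in-⇔ (allSubsets k))
             (filter-none _ (All.universal (λ L I⊆L → case I⊆L here of λ ()) (allSubsets k))) ⟨
  map (true ∷_) (filter (λ L → (true ∷ I) ⊆? (true ∷ L)) (allSubsets k)) ++
  map (false ∷_) (filter (λ L → (true ∷ I) ⊆? (false ∷ L)) (allSubsets k))
    ≡⟨ filter-allSubsets-suc ((true ∷ I) ⊆?_) ⟨
  filter ((true ∷ I) ⊆?_) (allSubsets (suc k)) ∎
  where open ≡-Reasoning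
map-superset-allSubsets {suc k} (false ∷ I) = begin
  map (superset (false ∷ I)) (map (true ∷_) Js ++ map (false ∷_) Js)
    ≡⟨ map-++ (superset (false ∷ I)) (map (true ∷_) Js) (map (false ∷_) Js) ⟩
  map (superset (false ∷ I)) (map (true ∷_) Js) ++ map (superset (false ∷ I)) (map (false ∷_) Js)
    ≡⟨ cong₂ _++_ (prefix true) (prefix false) ⟩
  map (true ∷_) (filter (λ L → (false ∷ I) ⊆? (true ∷ L)) (allSubsets k)) ++
  map (false ∷_) (filter (λ L → (false ∷ I) ⊆? (false ∷ L)) (allSubsets k))
    ≡⟨ filter-allSubsets-suc ((false ∷ I) ⊆?_) ⟨
  filter ((false ∷ I) ⊆?_) (allSubsets (suc k)) ∎
  where
  open ≡-Reasoning
  Js : List (Subset (size (∁ I)))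
  Js = allSubsets (size (∁ I))
  prefix : ∀ b → map (superset (false ∷ I)) (map (b ∷_) Js) ≡
                 map (b ∷_) (filter (λ L → (false ∷ I) ⊆? (b ∷ L)) (allSubsets k))
  prefix b = begin
    map (superset (false ∷ I)) (map (b ∷_) Js)                    ≡⟨ map-∘ Js ⟨
    map (λ J → b ∷ superset I J) Js                               ≡⟨ map-∘ Js ⟩
    map (b ∷_) (map (superset I) Js)                              ≡⟨ cong (map (b ∷_)) (map-superset-allSubsets I) ⟩
    map (b ∷_) (filter (I ⊆?_) (allSubsets k))
      ≡⟨ cong (map (b ∷_)) (filter-⇔ _ _ out⊆-⇔ (allSubsets k)) ⟨
    map (b ∷_) (filter (λ L → (false ∷ I) ⊆? (b ∷ L)) (allSubsets k)) ∎

map-embSubset-allSubsets : ∀ {k} (L : Subset k) →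
  map (embSubset L) (allSubsets (size L)) ≡ filter (_⊆? L) (allSubsets k)
map-embSubset-allSubsets []          = refl
map-embSubset-allSubsets {suc k} (true ∷ L) = begin
  map (embSubset (true ∷ L)) (map (true ∷_) Ms ++ map (false ∷_) Ms)
    ≡⟨ map-++ (embSubset (true ∷ L)) (map (true ∷_) Ms) (map (false ∷_) Ms) ⟩
  map (embSubset (true ∷ L)) (map (true ∷_) Ms) ++ map (embSubset (true ∷ L)) (map (false ∷_) Ms)
    ≡⟨ cong₂ _++_ (prefix true in⊆in-⇔) (prefix false out⊆-⇔) ⟩
  map (true ∷_) (filter (λ M → (true ∷ M) ⊆? (true ∷ L)) (allSubsets k)) ++
  map (false ∷_) (filter (λ M → (false ∷ M) ⊆? (true ∷ L)) (allSubsets k))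
    ≡⟨ filter-allSubsets-suc (_⊆? (true ∷ L)) ⟨
  filter (_⊆? (true ∷ L)) (allSubsets (suc k)) ∎
  where
  open ≡-Reasoning
  Ms : List (Subset (size L))
  Ms = allSubsets (size L)
  prefix : ∀ b → (∀ {M} → M ⊆ L ⇔ (b ∷ M) ⊆ (true ∷ L)) →
           map (embSubset (true ∷ L)) (map (b ∷_) Ms) ≡
           map (b ∷_) (filter (λ M → (b ∷ M) ⊆? (true ∷ L)) (allSubsets k))
  prefix b M⊆L⇔ = begin
    map (embSubset (true ∷ L)) (map (b ∷_) Ms)                   ≡⟨ map-∘ Ms ⟨
    map (λ J → b ∷ embSubset L J) Ms                             ≡⟨ map-∘ Ms ⟩
    map (b ∷_) (map (embSubset L) Ms)                            ≡⟨ cong (map (b ∷_)) (map-embSubset-allSubsets L) ⟩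
    map (b ∷_) (filter (_⊆? L) (allSubsets k))
      ≡⟨ cong (map (b ∷_)) (filter-⇔ _ _ M⊆L⇔ (allSubsets k)) ⟨
    map (b ∷_) (filter (λ M → (b ∷ M) ⊆? (true ∷ L)) (allSubsets k)) ∎
map-embSubset-allSubsets {suc k} (false ∷ L) = begin
  map (embSubset (false ∷ L)) (allSubsets (size L))
    ≡⟨ map-∘ (allSubsets (size L)) ⟩
  map (false ∷_) (map (embSubset L) (allSubsets (size L)))
    ≡⟨ cong (map (false ∷_)) (map-embSubset-allSubsets L) ⟩
  map (false ∷_) (filter (_⊆? L) (allSubsets k))
    ≡⟨ cong₂ (λ xs ys → map (true ∷_) xs ++ map (false ∷_) ys)
             (filter-none _ (All.universal (λ M M⊆L → case M⊆L here of λ ()) (allSubsets k)))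
             (filter-⇔ _ _ out⊆-⇔ (allSubsets k)) ⟨
  map (true ∷_) (filter (λ M → (true ∷ M) ⊆? (false ∷ L)) (allSubsets k)) ++
  map (false ∷_) (filter (λ M → (false ∷ M) ⊆? (false ∷ L)) (allSubsets k))
    ≡⟨ filter-allSubsets-suc (_⊆? (false ∷ L)) ⟨
  filter (_⊆? (false ∷ L)) (allSubsets (suc k)) ∎
  where open ≡-Reasoning

-- Induced subgraphs and ideals

induced-⊤ : ∀ G → induced G ⊤ ≃ G
induced-⊤ G = ≃-via ↔-refl (emb-⊤-↔ (n G)) (λ _ _ → refl) (λ _ _ → refl)

induced-⊥ : ∀ G → induced G ⊥ ≃ emptyGraph
induced-⊥ G = ≃-emptyGraph (induced G ⊥) (size-⊥ (n G))

induced-induced : ∀ G (S : Subset (n G)) J → induced (induced G S) J ≃ induced G (embSubset S J)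
induced-induced G S J = ≃-via ↔-refl (embSubset-↔ S J)
  (λ i j → sym (cong₂ (E G) (emb-embSubset S J i) (emb-embSubset S J j)))
  (λ i j → sym (cong₂ (A G) (emb-embSubset S J i) (emb-embSubset S J j)))

induced-↷ : ∀ G H (S : Subset (n G)) (T : Subset (n H)) →
            induced (G ↷ H) (S ++ᵛ T) ≃ induced G S ↷ induced H T
induced-↷ G H S T = ≃-via (++-↔ S T) (↔-sym +↔⊎)
  (λ u v → trans (cong₂ (E (G ↷ H)) (emb-++ S T u) (emb-++ S T v))
                 (Edges.rel-↷-join-map {induced G S} {G} {induced H T} {H} (λ _ _ → refl) (λ _ _ → refl) u v))
  (λ u v → trans (cong₂ (A (G ↷ H)) (emb-++ S T u) (emb-++ S T v))
                 (Arcs.rel-↷-join-map {induced G S} {G} {induced H T} {H} (λ _ _ → refl) (λ _ _ → refl) u v))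

⊤-isIdeal : ∀ G → IsIdeal G ⊤
⊤-isIdeal G _ _ _ _ = ∈⊤

⊥-isIdeal : ∀ G → IsIdeal G ⊥
⊥-isIdeal G _ _ x∈⊥ _ = contradiction x∈⊥ ∉⊥

isIdeal-superset⇔ : ∀ G I → IsIdeal G I → ∀ J → IsIdeal (induced G (∁ I)) J ⇔ IsIdeal G (superset I J)
isIdeal-superset⇔ G I I-ideal J = mk⇔ forward backward
  where
  forward : IsIdeal (induced G (∁ I)) J → IsIdeal G (superset I J)
  forward J-ideal x y x∈ axy with x∈p∪q⁻ I (embSubset (∁ I) J) x∈
  ... | inj₁ x∈I = x∈p∪q⁺ (inj₁ (I-ideal x y x∈I axy))
  ... | inj₂ x∈J with ∈⇒emb (∁ I) (embSubset-⊆ (∁ I) J x∈J)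
  ...   | i , refl with y ∈? I
  ...     | yes y∈I = x∈p∪q⁺ (inj₁ y∈I)
  ...     | no  y∉I with ∈⇒emb (∁ I) (x∉p⇒x∈∁p y∉I)
  ...       | j , refl =
    x∈p∪q⁺ (inj₂ (∈-embSubset⁺ (∁ I) J (J-ideal i j (∈-embSubset⁻ (∁ I) J i x∈J) axy)))
  backward : IsIdeal G (superset I J) → IsIdeal (induced G (∁ I)) J
  backward L-ideal i j i∈J aij
    with x∈p∪q⁻ I (embSubset (∁ I) J) (L-ideal _ _ (x∈p∪q⁺ (inj₂ (∈-embSubset⁺ (∁ I) J i∈J))) aij)
  ... | inj₁ j∈I = contradiction j∈I (x∈∁p⇒x∉p (emb-∈ (∁ I) j))
  ... | inj₂ j∈J = ∈-embSubset⁻ (∁ I) J j j∈J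

isIdeal-embSubset⇔ : ∀ G L → IsIdeal G L → ∀ K → IsIdeal (induced G L) K ⇔ IsIdeal G (embSubset L K)
isIdeal-embSubset⇔ G L L-ideal K = mk⇔ forward backward
  where
  forward : IsIdeal (induced G L) K → IsIdeal G (embSubset L K)
  forward K-ideal x y x∈ axy with ∈⇒emb L (embSubset-⊆ L K x∈)
  ... | i , refl with ∈⇒emb L (L-ideal _ y (embSubset-⊆ L K x∈) axy)
  ...   | j , refl = ∈-embSubset⁺ L K (K-ideal i j (∈-embSubset⁻ L K i x∈) axy)
  backward : IsIdeal G (embSubset L K) → IsIdeal (induced G L) K
  backward K-ideal i j i∈ aij = ∈-embSubset⁻ L K j (K-ideal _ _ (∈-embSubset⁺ L K i∈) aij)

ideals-↭-∷ : ∀ G {S} → IsIdeal G S → ideals G ↭ S ∷ filter (λ I → ¬? (I ≟ˢ S)) (ideals G)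
ideals-↭-∷ G {S} S-ideal =
  ↭-trans (partition-↭ (_≟ˢ S) (ideals G)) (↭-reflexive (cong (_++ filter (λ I → ¬? (I ≟ˢ S)) (ideals G)) S-only))
  where
  open ≡-Reasoning
  S-only : filter (_≟ˢ S) (ideals G) ≡ [ S ]
  S-only = begin
    filter (_≟ˢ S) (filter (isIdeal? G) (allSubsets (n G)))  ≡⟨ filter-comm (_≟ˢ S) (isIdeal? G) (allSubsets (n G)) ⟩
    filter (isIdeal? G) (filter (_≟ˢ S) (allSubsets (n G)))
      ≡⟨ cong (filter (isIdeal? G)) (filter-≟-allSubsets (n G) S) ⟩
    filter (isIdeal? G) [ S ]                                ≡⟨ filter-accept (isIdeal? G) S-ideal ⟩
    [ S ]                                                    ∎

map-superset-ideals : ∀ G I → IsIdeal G I →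
  map (superset I) (ideals (induced G (∁ I))) ≡ filter (I ⊆?_) (ideals G)
map-superset-ideals G I I-ideal = begin
  map (superset I) (filter (isIdeal? (induced G (∁ I))) (allSubsets (size (∁ I))))
    ≡⟨ map-filter-⇔ (isIdeal? G) (isIdeal? (induced G (∁ I))) (superset I)
                    (λ {J} → isIdeal-superset⇔ G I I-ideal J) (allSubsets (size (∁ I))) ⟩
  filter (isIdeal? G) (map (superset I) (allSubsets (size (∁ I))))
    ≡⟨ cong (filter (isIdeal? G)) (map-superset-allSubsets I) ⟩
  filter (isIdeal? G) (filter (I ⊆?_) (allSubsets (n G)))
    ≡⟨ filter-comm (isIdeal? G) (I ⊆?_) (allSubsets (n G)) ⟩
  filter (I ⊆?_) (ideals G) ∎
  where open ≡-Reasoning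

map-embSubset-ideals : ∀ G L → IsIdeal G L →
  map (embSubset L) (ideals (induced G L)) ≡ filter (_⊆? L) (ideals G)
map-embSubset-ideals G L L-ideal = begin
  map (embSubset L) (filter (isIdeal? (induced G L)) (allSubsets (size L)))
    ≡⟨ map-filter-⇔ (isIdeal? G) (isIdeal? (induced G L)) (embSubset L)
                    (λ {K} → isIdeal-embSubset⇔ G L L-ideal K) (allSubsets (size L)) ⟩
  filter (isIdeal? G) (map (embSubset L) (allSubsets (size L)))
    ≡⟨ cong (filter (isIdeal? G)) (map-embSubset-allSubsets L) ⟩
  filter (isIdeal? G) (filter (_⊆? L) (allSubsets (n G)))
    ≡⟨ filter-comm (isIdeal? G) (_⊆? L) (allSubsets (n G)) ⟩
  filter (_⊆? L) (ideals G) ∎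
  where open ≡-Reasoning

↑-view : ∀ m k (i : Fin (m +ℕ k)) → (∃ λ x → x ↑ˡ k ≡ i) ⊎ (∃ λ y → m ↑ʳ y ≡ i)
↑-view m k i with splitAt m i in eq
... | inj₁ x = inj₁ (x , splitAt⁻¹-↑ˡ eq)
... | inj₂ y = inj₂ (y , splitAt⁻¹-↑ʳ eq)

module _ (G H : MixedGraph) where
  private
    m = n G
    k = n H
    S≢⊥? : (S : Subset m) → Dec (S ≢ ⊥)
    S≢⊥? S = ¬? (S ≟ˢ ⊥)

  isIdeal-⊥++⇔ : ∀ T → IsIdeal (G ↷ H) (⊥ ++ᵛ T) ⇔ IsIdeal H T
  isIdeal-⊥++⇔ T = mk⇔ forward backward
    where
    forward : IsIdeal (G ↷ H) (⊥ ++ᵛ T) → IsIdeal H T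
    forward ideal y y′ y∈ a = ∈-↑ʳ-++⁻ ⊥ T
      (ideal (m ↑ʳ y) (m ↑ʳ y′) (∈-↑ʳ-++⁺ ⊥ T y∈) (trans (A-↷-join G H (inj₂ y) (inj₂ y′)) a))
    backward : IsIdeal H T → IsIdeal (G ↷ H) (⊥ ++ᵛ T)
    backward T-ideal i j i∈ a with ↑-view m k i | ↑-view m k j
    ... | inj₁ (x , refl) | _ = contradiction (∈-↑ˡ-++⁻ ⊥ T i∈) ∉⊥
    ... | inj₂ (y , refl) | inj₁ (x , refl) = case trans (sym (A-↷-join G H (inj₂ y) (inj₁ x))) a of λ ()
    ... | inj₂ (y , refl) | inj₂ (y′ , refl) =
      ∈-↑ʳ-++⁺ ⊥ T (T-ideal y y′ (∈-↑ʳ-++⁻ ⊥ T i∈) (trans (sym (A-↷-join G H (inj₂ y) (inj₂ y′))) a))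

  isIdeal-++⇔ : ∀ S T → S ≢ ⊥ → IsIdeal (G ↷ H) (S ++ᵛ T) ⇔ (IsIdeal G S × T ≡ ⊤)
  isIdeal-++⇔ S T S≢⊥ = mk⇔ forward backward
    where
    forward : IsIdeal (G ↷ H) (S ++ᵛ T) → IsIdeal G S × T ≡ ⊤
    forward ideal = S-ideal , ⊆-antisym ⊆⊤ (λ {y} _ → T-full y)
      where
      S-ideal : IsIdeal G S
      S-ideal x x′ x∈ a = ∈-↑ˡ-++⁻ S T
        (ideal (x ↑ˡ k) (x′ ↑ˡ k) (∈-↑ˡ-++⁺ S T x∈) (trans (A-↷-join G H (inj₁ x) (inj₁ x′)) a))
      T-full : ∀ y → y ∈ T
      T-full y = let x , x∈S = ≢⊥⇒nonempty S S≢⊥ in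
        ∈-↑ʳ-++⁻ S T (ideal (x ↑ˡ k) (m ↑ʳ y) (∈-↑ˡ-++⁺ S T x∈S) (A-↷-join G H (inj₁ x) (inj₂ y)))
    backward : IsIdeal G S × T ≡ ⊤ → IsIdeal (G ↷ H) (S ++ᵛ T)
    backward (S-ideal , refl) i j i∈ a with ↑-view m k i | ↑-view m k j
    ... | _ | inj₂ (y′ , refl) = ∈-↑ʳ-++⁺ S ⊤ ∈⊤
    ... | inj₁ (x , refl) | inj₁ (x′ , refl) =
      ∈-↑ˡ-++⁺ S ⊤ (S-ideal x x′ (∈-↑ˡ-++⁻ S ⊤ i∈) (trans (sym (A-↷-join G H (inj₁ x) (inj₁ x′))) a))
    ... | inj₂ (y , refl) | inj₁ (x′ , refl) = case trans (sym (A-↷-join G H (inj₂ y) (inj₁ x′))) a of λ ()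


  idealsOver : Subset m → List (Subset (m +ℕ k))
  idealsOver S = map (S ++ᵛ_) (filter (λ T → isIdeal? (G ↷ H) (S ++ᵛ T)) (allSubsets k))

  idealsOver-⊥ : idealsOver ⊥ ≡ map (⊥ ++ᵛ_) (ideals H)
  idealsOver-⊥ = cong (map (⊥ ++ᵛ_))
    (filter-⇔ _ (isIdeal? H) (λ {T} → ⇔-sym (isIdeal-⊥++⇔ T)) (allSubsets k))

  idealsOver-≢⊥ : ∀ S → S ≢ ⊥ → (S-ideal? : Dec (IsIdeal G S)) →
                  idealsOver S ≡ (if does S-ideal? then [ S ++ᵛ ⊤ ] else [])
  idealsOver-≢⊥ S S≢⊥ (yes S-ideal) =
    cong (map (S ++ᵛ_)) (trans (filter-⇔ _ (_≟ˢ ⊤) T≡⊤⇔ (allSubsets k)) (filter-≟-allSubsets k ⊤))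
    where
    T≡⊤⇔ : ∀ {T} → T ≡ ⊤ ⇔ IsIdeal (G ↷ H) (S ++ᵛ T)
    T≡⊤⇔ {T} = mk⇔ (λ T≡⊤ → Equivalence.from (isIdeal-++⇔ S T S≢⊥) (S-ideal , T≡⊤))
                   (λ ideal → proj₂ (Equivalence.to (isIdeal-++⇔ S T S≢⊥) ideal))
  idealsOver-≢⊥ S S≢⊥ (no ¬S-ideal) = cong (map (S ++ᵛ_)) (filter-none _ (All.universal
          (λ T ideal → ¬S-ideal (proj₁ (Equivalence.to (isIdeal-++⇔ S T S≢⊥) ideal))) (allSubsets k)))

  concatMap-idealsOver-≢⊥ :
    concatMap idealsOver (filter S≢⊥? (allSubsets m)) ≡ map (_++ᵛ ⊤) (filter S≢⊥? (ideals G))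
  concatMap-idealsOver-≢⊥ = begin
    concatMap idealsOver (filter S≢⊥? (allSubsets m))
      ≡⟨ cong concat (map-cong-local
           (All.map (λ {S} S≢⊥ → idealsOver-≢⊥ S S≢⊥ (isIdeal? G S)) (all-filter S≢⊥? (allSubsets m)))) ⟩
    concatMap (λ S → if does (isIdeal? G S) then [ S ++ᵛ ⊤ ] else []) (filter S≢⊥? (allSubsets m))
      ≡⟨ map-filter≡concatMap (isIdeal? G) (_++ᵛ ⊤) (filter S≢⊥? (allSubsets m)) ⟨
    map (_++ᵛ ⊤) (filter (isIdeal? G) (filter S≢⊥? (allSubsets m)))
      ≡⟨ cong (map (_++ᵛ ⊤)) (filter-comm (isIdeal? G) S≢⊥? (allSubsets m)) ⟩
    map (_++ᵛ ⊤) (filter S≢⊥? (ideals G)) ∎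
    where open ≡-Reasoning

  ideals-↷ : ideals (G ↷ H) ↭ map (⊥ ++ᵛ_) (ideals H) ++ map (_++ᵛ ⊤) (filter (λ S → ¬? (S ≟ˢ ⊥)) (ideals G))
  ideals-↷ = begin
    filter (isIdeal? (G ↷ H)) (allSubsets (m +ℕ k))
      ≡⟨ cong (filter (isIdeal? (G ↷ H))) (allSubsets-+ m k) ⟩
    filter (isIdeal? (G ↷ H)) (concatMap (λ S → map (S ++ᵛ_) (allSubsets k)) (allSubsets m))
      ≡⟨ filter-concatMap (isIdeal? (G ↷ H)) _ (allSubsets m) ⟩
    concatMap (λ S → filter (isIdeal? (G ↷ H)) (map (S ++ᵛ_) (allSubsets k))) (allSubsets m)
      ≡⟨ concatMap-cong (λ S → filter-map (isIdeal? (G ↷ H)) (S ++ᵛ_) (allSubsets k)) (allSubsets m) ⟩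
    concatMap idealsOver (allSubsets m)
      ↭⟨ concatMap-↭ idealsOver (partition-↭ (_≟ˢ ⊥) (allSubsets m)) ⟩
    concatMap idealsOver (filter (_≟ˢ ⊥) (allSubsets m) ++ filter S≢⊥? (allSubsets m))
      ≡⟨ concatMap-++ idealsOver (filter (_≟ˢ ⊥) (allSubsets m)) (filter S≢⊥? (allSubsets m)) ⟩
    concatMap idealsOver (filter (_≟ˢ ⊥) (allSubsets m)) ++ concatMap idealsOver (filter S≢⊥? (allSubsets m))
      ≡⟨ cong₂ _++_ (trans (cong (concatMap idealsOver) (filter-≟-allSubsets m ⊥))
                           (trans (++-identityʳ _) idealsOver-⊥))
                    concatMap-idealsOver-≢⊥ ⟩
    map (⊥ ++ᵛ_) (ideals H) ++ map (_++ᵛ ⊤) (filter S≢⊥? (ideals G)) ∎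
    where open PermutationReasoning

-- Formal sums

module FreeModuleProperties {c ℓ} (R : CommutativeRing c ℓ) where
  open CommutativeRing R using (_≈_; _*_; -_; 0#; 1#) renaming (Carrier to K)
  private module R = CommutativeRing R
  open FreeModule R

  module _ {b e} {B : Set b} (_~_ : B → B → Set e) where

    ≋-setoid : Setoid (c ⊔ b) (c ⊔ ℓ ⊔ b ⊔ e)
    ≋-setoid = record
      { Carrier       = FM B
      ; _≈_           = Equiv _~_
      ; isEquivalence = record { refl = ≡⇒≈ refl ; sym = ≈-sym ; trans = ≈-trans }
      }

  module _ {b e} {B : Set b} {_~_ : B → B → Set e} where
    private
      infix 4 _≋_
      _≋_ : FM B → FM B → Set _
      _≋_ = Equiv _~_

    ↭⇒≋ : ∀ {x y} → x ↭ y → x ≋ y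
    ↭⇒≋ Perm.refl          = ≡⇒≈ refl
    ↭⇒≋ (Perm.prep p q)    = ++-cong {x = [ p ]} (≡⇒≈ refl) (↭⇒≋ q)
    ↭⇒≋ (Perm.swap p q r)  = ++-cong {x = p ∷ q ∷ []} {x′ = q ∷ p ∷ []} (++-swap [ p ] [ q ]) (↭⇒≋ r)
    ↭⇒≋ (Perm.trans p q)   = ≈-trans (↭⇒≋ p) (↭⇒≋ q)

    concatMap-cong-≋ : ∀ {a} {X : Set a} {f g : X → FM B} (xs : List X) →
                       (∀ x → f x ≋ g x) → concatMap f xs ≋ concatMap g xs
    concatMap-cong-≋ []       f≋g = ≡⇒≈ refl
    concatMap-cong-≋ (x ∷ xs) f≋g = ++-cong (f≋g x) (concatMap-cong-≋ xs f≋g)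

    concatMap-cong-≋-All : ∀ {a p} {X : Set a} {P : X → Set p} {f g : X → FM B} {xs : List X} →
                           All P xs → (∀ x → P x → f x ≋ g x) → concatMap f xs ≋ concatMap g xs
    concatMap-cong-≋-All []         f≋g = ≡⇒≈ refl
    concatMap-cong-≋-All (px ∷ pxs) f≋g = ++-cong (f≋g _ px) (concatMap-cong-≋-All pxs f≋g)

    map-cong-≋ : ∀ {a} {X : Set a} {f g : X → K × B} (xs : List X) →
                 (∀ x → [ f x ] ≋ [ g x ]) → map f xs ≋ map g xs
    map-cong-≋ []       f≋g = ≡⇒≈ refl
    map-cong-≋ (x ∷ xs) f≋g = ++-cong (f≋g x) (map-cong-≋ xs f≋g)

    [-]-cong : ∀ {a a′ g g′} → a ≈ a′ → g ~ g′ → [ (a , g) ] ≋ [ (a′ , g′) ]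
    [-]-cong {g = g} a≈a′ g~g′ = ≈-trans (coeff-cong g a≈a′) (basis-cong _ g~g′)

    map-≈0 : ∀ {a p} {X : Set a} {P : X → Set p} (f : X → K × B) {xs} →
             (∀ x → P x → proj₁ (f x) ≈ 0#) → All P xs → map f xs ≋ []
    map-≈0 f f≈0 []         = ≡⇒≈ refl
    map-≈0 f f≈0 (px ∷ pxs) =
      ++-cong {x′ = []} (≈-trans (coeff-cong _ (f≈0 _ px)) (zero-coeff _)) (map-≈0 f f≈0 pxs)

    [a,-a]≋[] : ∀ a g → (a , g) ∷ (- a , g) ∷ [] ≋ []
    [a,-a]≋[] a g = ≈-trans (merge a (- a) g) (≈-trans (coeff-cong g (R.-‿inverseʳ a)) (zero-coeff g))

    bilin-identityˡ : ∀ {f : B → B → B} {u} → (∀ g → f u g ~ g) → ∀ x → bilin f [ (1# , u) ] x ≋ x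
    bilin-identityˡ {f} {u} fu~ x = ≈-trans (≡⇒≈ (++-identityʳ _))
      (≈-trans (map-cong-≋ x (λ p → [-]-cong (R.*-identityˡ (proj₁ p)) (fu~ (proj₂ p)))) (≡⇒≈ (map-id x)))

    bilin-identityʳ : ∀ {f : B → B → B} {u} → (∀ g → f g u ~ g) → ∀ x → bilin f x [ (1# , u) ] ≋ x
    bilin-identityʳ {f} {u} fu~ x = ≈-trans
      (concatMap-cong-≋ x (λ p → [-]-cong (R.*-identityʳ (proj₁ p)) (fu~ (proj₂ p)))) (≡⇒≈ (concatMap-pure x))

    bilin-assoc : ∀ {f : B → B → B} → (∀ g h k → f (f g h) k ~ f g (f h k)) →
                  ∀ x y z → bilin f (bilin f x y) z ≋ bilin f x (bilin f y z)
    bilin-assoc {f} f-assoc []              y z = ≡⇒≈ refl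
    bilin-assoc {f} f-assoc ((a , g) ∷ x) y z = ≈-trans
      (≡⇒≈ (concatMap-++ _ (map (left a g) y) (bilin f x y)))
      (++-cong (term y) (bilin-assoc f-assoc x y z))
      where
      left : K → B → K × B → K × B
      left a g (b , h) = (a * b , f g h)
      term : ∀ y → bilin f (map (left a g) y) z ≋ map (left a g) (bilin f y z)
      term []              = ≡⇒≈ refl
      term ((b , h) ∷ y) = ≈-trans
        (++-cong (map-cong-≋ z (λ q → [-]-cong (R.*-assoc a b (proj₁ q)) (f-assoc g h (proj₂ q)))) (term y))
        (≈-trans (++-cong (≡⇒≈ (map-∘ z)) (≡⇒≈ refl))
                 (≡⇒≈ (sym (map-++ (left a g) (map (left b h) z) (bilin f y z)))))

-- The bialgebra F[G]

module Bialgebra {c ℓ} (R : CommutativeRing c ℓ) where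
  open CommutativeRing R using (_≈_; _*_; -_; 0#; 1#) renaming (Carrier to K)
  private module R = CommutativeRing R
  open GraphBialgebra R
  open FreeModuleProperties R

  ⋅-assoc : ∀ x y z → (x ⋅ y) ⋅ z ≈₁ x ⋅ (y ⋅ z)
  ⋅-assoc = bilin-assoc {f = _↷_} (λ g h k → ≅ (↷-assoc g h k))

  ⋅-identityˡ : ∀ x → 𝟙 ⋅ x ≈₁ x
  ⋅-identityˡ = bilin-identityˡ {f = _↷_} {u = emptyGraph} (λ g → ≅ (↷-identityˡ g))

  ⋅-identityʳ : ∀ x → x ⋅ 𝟙 ≈₁ x
  ⋅-identityʳ = bilin-identityʳ {f = _↷_} {u = emptyGraph} (λ g → ≅ (↷-identityʳ g))

  ε₀-empty : ∀ G → n G ≡ 0 → ε₀ G ≡ 1#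
  ε₀-empty (mkGraph zero _ _ _ _ _ _) _ = refl

  ε₀-nonempty : ∀ G → n G ≢ 0 → ε₀ G ≡ 0#
  ε₀-nonempty (mkGraph zero    _ _ _ _ _ _) n≢0 = contradiction refl n≢0
  ε₀-nonempty (mkGraph (suc _) _ _ _ _ _ _) _   = refl

  sum-ideals-≋-single : ∀ {B : Set} {_~_ : B → B → Set} G {S} → IsIdeal G S → (F : Subset (n G) → K × B) →
                        (∀ I → I ≢ S → proj₁ (F I) ≈ 0#) → Equiv _~_ (map F (ideals G)) [ F S ]
  sum-ideals-≋-single G {S} S-ideal F F≈0 = ≈-trans (↭⇒≋ (map⁺ F (ideals-↭-∷ G S-ideal)))
    (++-cong {x = [ F S ]} (≡⇒≈ refl) (map-≈0 F F≈0 (all-filter (λ I → ¬? (I ≟ˢ S)) (ideals G))))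

  Δ₀-counitˡ : ∀ a G → ε⊗id (scale a (Δ₀ G)) ≈₁ [ (a , G) ]
  Δ₀-counitˡ a G = ≈-trans (≡⇒≈ (map-map-map _ _ _ (ideals G)))
    (≈-trans (sum-ideals-≋-single G (⊤-isIdeal G) term term≈0) ([-]-cong coefficient (≅ (induced-⊤ G))))
    where
    term : Subset (n G) → K × MixedGraph
    term I = ((a * 1#) * ε₀ (induced G (∁ I)) , induced G I)
    coefficient : (a * 1#) * ε₀ (induced G (∁ ⊤)) ≈ a
    coefficient = R.trans (R.reflexive (cong ((a * 1#) *_)
                    (ε₀-empty (induced G (∁ ⊤)) (trans (cong size (∁-⊤ (n G))) (size-⊥ (n G))))))
                    (R.trans (R.*-identityʳ _) (R.*-identityʳ a))
    term≈0 : ∀ I → I ≢ ⊤ → proj₁ (term I) ≈ 0#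
    term≈0 I I≢⊤ = R.trans (R.reflexive (cong ((a * 1#) *_)
                     (ε₀-nonempty (induced G (∁ I)) (λ e → I≢⊤ (size-∁≡0⇒≡⊤ I e))))) (R.zeroʳ _)

  Δ₀-counitʳ : ∀ a G → id⊗ε (scale a (Δ₀ G)) ≈₁ [ (a , G) ]
  Δ₀-counitʳ a G = ≈-trans (≡⇒≈ (map-map-map _ _ _ (ideals G)))
    (≈-trans (sum-ideals-≋-single G (⊥-isIdeal G) term term≈0)
             ([-]-cong coefficient (≅ (≃-trans (≡⇒≃ (cong (induced G) (∁-⊥ (n G)))) (induced-⊤ G)))))
    where
    term : Subset (n G) → K × MixedGraph
    term I = ((a * 1#) * ε₀ (induced G I) , induced G (∁ I))
    coefficient : (a * 1#) * ε₀ (induced G ⊥) ≈ a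
    coefficient = R.trans (R.reflexive (cong ((a * 1#) *_) (ε₀-empty (induced G ⊥) (size-⊥ (n G)))))
                    (R.trans (R.*-identityʳ _) (R.*-identityʳ a))
    term≈0 : ∀ I → I ≢ ⊥ → proj₁ (term I) ≈ 0#
    term≈0 I I≢⊥ = R.trans (R.reflexive (cong ((a * 1#) *_)
                     (ε₀-nonempty (induced G I) (λ e → I≢⊥ (size≡0⇒≡⊥ I e))))) (R.zeroʳ _)

  Δ-counitˡ : ∀ x → ε⊗id (Δ x) ≈₁ x
  Δ-counitˡ x = ≈-trans (≡⇒≈ (map-concatMap _ _ x))
    (≈-trans (concatMap-cong-≋ x (λ { (a , G) → Δ₀-counitˡ a G })) (≡⇒≈ (concatMap-pure x)))

  Δ-counitʳ : ∀ x → id⊗ε (Δ x) ≈₁ x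
  Δ-counitʳ x = ≈-trans (≡⇒≈ (map-concatMap _ _ x))
    (≈-trans (concatMap-cong-≋ x (λ { (a , G) → Δ₀-counitʳ a G })) (≡⇒≈ (concatMap-pure x)))

  module _ (G : MixedGraph) (a : K) where
    private
      a′ : K
      a′ = (a * 1#) * 1#

    layers : Subset (n G) → Subset (n G) → MixedGraph × MixedGraph × MixedGraph
    layers I L = (induced G (∁ L) , induced G (L ∩ ∁ I) , induced G I)

    Δ⊗id-Δ₀ : Δ⊗id (scale a (Δ₀ G)) ≈₃
              concatMap (λ I → map (λ L → (a′ , layers I L)) (filter (I ⊆?_) (ideals G))) (ideals G)
    Δ⊗id-Δ₀ = begin
      Δ⊗id (scale a (Δ₀ G))
        ≡⟨ cong (concatMap _) (sym (map-∘ (ideals G))) ⟩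
      concatMap _ (map _ (ideals G))
        ≡⟨ concatMap-map _ _ (ideals G) ⟩
      concatMap _ (ideals G)
        ≡⟨ concatMap-cong (λ I → map-map-map _ _ _ _) (ideals G) ⟩
      concatMap (λ I → map (λ J → (a′ , induced (induced G (∁ I)) (∁ J) , induced (induced G (∁ I)) J , induced G I))
                           (ideals (induced G (∁ I)))) (ideals G)
        ≈⟨ concatMap-cong-≋-All (all-filter (isIdeal? G) (allSubsets (n G))) lower ⟩
      concatMap (λ I → map (λ L → (a′ , layers I L)) (filter (I ⊆?_) (ideals G))) (ideals G) ∎
      where
      open ≈-Reasoning (≋-setoid _≅³_)
      lower : ∀ I → IsIdeal G I →
        map (λ J → (a′ , induced (induced G (∁ I)) (∁ J) , induced (induced G (∁ I)) J , induced G I))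
            (ideals (induced G (∁ I))) ≈₃
        map (λ L → (a′ , layers I L)) (filter (I ⊆?_) (ideals G))
      lower I I-ideal = begin
        map _ (ideals (induced G (∁ I)))
          ≈⟨ map-cong-≋ (ideals (induced G (∁ I))) (λ J → [-]-cong R.refl
               ( ≅ (≃-trans (induced-induced G (∁ I) (∁ J)) (≡⇒≃ (cong (induced G) (sym (∁-superset I J)))))
               , ≅ (≃-trans (induced-induced G (∁ I) J) (≡⇒≃ (cong (induced G) (sym (superset-∩-∁ I J)))))
               , ≅ (≃-refl {induced G I}))) ⟩
        map (λ J → (a′ , layers I (superset I J))) (ideals (induced G (∁ I)))
          ≡⟨ map-∘ (ideals (induced G (∁ I))) ⟩
        map (λ L → (a′ , layers I L)) (map (superset I) (ideals (induced G (∁ I))))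
          ≡⟨ cong (map (λ L → (a′ , layers I L))) (map-superset-ideals G I I-ideal) ⟩
        map (λ L → (a′ , layers I L)) (filter (I ⊆?_) (ideals G)) ∎

    id⊗Δ-Δ₀ : id⊗Δ (scale a (Δ₀ G)) ≈₃
              concatMap (λ L → map (λ I → (a′ , layers I L)) (filter (_⊆? L) (ideals G))) (ideals G)
    id⊗Δ-Δ₀ = begin
      id⊗Δ (scale a (Δ₀ G))
        ≡⟨ cong (concatMap _) (sym (map-∘ (ideals G))) ⟩
      concatMap _ (map _ (ideals G))
        ≡⟨ concatMap-map _ _ (ideals G) ⟩
      concatMap _ (ideals G)
        ≡⟨ concatMap-cong (λ I → map-map-map _ _ _ _) (ideals G) ⟩
      concatMap (λ L → map (λ K → (a′ , induced G (∁ L) , induced (induced G L) (∁ K) , induced (induced G L) K))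
                           (ideals (induced G L))) (ideals G)
        ≈⟨ concatMap-cong-≋-All (all-filter (isIdeal? G) (allSubsets (n G))) upper ⟩
      concatMap (λ L → map (λ I → (a′ , layers I L)) (filter (_⊆? L) (ideals G))) (ideals G) ∎
      where
      open ≈-Reasoning (≋-setoid _≅³_)
      upper : ∀ L → IsIdeal G L →
        map (λ K → (a′ , induced G (∁ L) , induced (induced G L) (∁ K) , induced (induced G L) K))
            (ideals (induced G L)) ≈₃
        map (λ I → (a′ , layers I L)) (filter (_⊆? L) (ideals G))
      upper L L-ideal = begin
        map _ (ideals (induced G L))
          ≈⟨ map-cong-≋ (ideals (induced G L)) (λ K → [-]-cong R.refl
               ( ≅ (≃-refl {induced G (∁ L)})
               , ≅ (≃-trans (induced-induced G L (∁ K)) (≡⇒≃ (cong (induced G) (embSubset-∁ L K))))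
               , ≅ (induced-induced G L K))) ⟩
        map (λ K → (a′ , layers (embSubset L K) L)) (ideals (induced G L))
          ≡⟨ map-∘ (ideals (induced G L)) ⟩
        map (λ I → (a′ , layers I L)) (map (embSubset L) (ideals (induced G L)))
          ≡⟨ cong (map (λ I → (a′ , layers I L))) (map-embSubset-ideals G L L-ideal) ⟩
        map (λ I → (a′ , layers I L)) (filter (_⊆? L) (ideals G)) ∎

    Δ₀-coassoc : Δ⊗id (scale a (Δ₀ G)) ≈₃ id⊗Δ (scale a (Δ₀ G))
    Δ₀-coassoc = ≈-trans Δ⊗id-Δ₀ (≈-trans
      (↭⇒≋ (concatMap-filter-comm _⊆?_ (λ I L → (a′ , layers I L)) (ideals G) (ideals G))) (≈-sym id⊗Δ-Δ₀))

  Δ-coassoc : ∀ x → Δ⊗id (Δ x) ≈₃ id⊗Δ (Δ x)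
  Δ-coassoc x = ≈-trans (≡⇒≈ (concatMap-concatMap _ _ x)) (≈-trans
    (concatMap-cong-≋ x (λ { (a , G) → Δ₀-coassoc G a })) (≡⇒≈ (sym (concatMap-concatMap _ _ x))))

  module _ (G H : MixedGraph) where
    private
      m = n G
      k = n H
      GH = G ↷ H

    cut-⊥++ : ∀ T → (induced GH (∁ (⊥ ++ᵛ T)) , induced GH (⊥ ++ᵛ T)) ≅²
                    (G ↷ induced H (∁ T) , emptyGraph ↷ induced H T)
    cut-⊥++ T = ≅ complement , ≅ ideal
      where
      open ≃-Reasoning
      complement : induced GH (∁ (⊥ ++ᵛ T)) ≃ G ↷ induced H (∁ T)
      complement = begin
        induced GH (∁ (⊥ ++ᵛ T))          ≡⟨ cong (induced GH) (trans (∁-++ ⊥ T) (cong (_++ᵛ ∁ T) (∁-⊥ m))) ⟩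
        induced GH (⊤ ++ᵛ ∁ T)            ≃⟨ induced-↷ G H ⊤ (∁ T) ⟩
        induced G ⊤ ↷ induced H (∁ T)     ≃⟨ ↷-cong (induced-⊤ G) ≃-refl ⟩
        G ↷ induced H (∁ T)               ∎
      ideal : induced GH (⊥ ++ᵛ T) ≃ emptyGraph ↷ induced H T
      ideal = begin
        induced GH (⊥ ++ᵛ T)              ≃⟨ induced-↷ G H ⊥ T ⟩
        induced G ⊥ ↷ induced H T         ≃⟨ ↷-cong (induced-⊥ G) ≃-refl ⟩
        emptyGraph ↷ induced H T          ∎

    cut-++⊤ : ∀ S → (induced GH (∁ (S ++ᵛ ⊤)) , induced GH (S ++ᵛ ⊤)) ≅²
                    (induced G (∁ S) ↷ emptyGraph , induced G S ↷ H)
    cut-++⊤ S = ≅ complement , ≅ ideal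
      where
      open ≃-Reasoning
      complement : induced GH (∁ (S ++ᵛ ⊤)) ≃ induced G (∁ S) ↷ emptyGraph
      complement = begin
        induced GH (∁ (S ++ᵛ ⊤))          ≡⟨ cong (induced GH) (trans (∁-++ S ⊤) (cong (∁ S ++ᵛ_) (∁-⊤ k))) ⟩
        induced GH (∁ S ++ᵛ ⊥)            ≃⟨ induced-↷ G H (∁ S) ⊥ ⟩
        induced G (∁ S) ↷ induced H ⊥     ≃⟨ ↷-cong ≃-refl (induced-⊥ H) ⟩
        induced G (∁ S) ↷ emptyGraph      ∎
      ideal : induced GH (S ++ᵛ ⊤) ≃ induced G S ↷ H
      ideal = begin
        induced GH (S ++ᵛ ⊤)              ≃⟨ induced-↷ G H S ⊤ ⟩
        induced G S ↷ induced H ⊤         ≃⟨ ↷-cong ≃-refl (induced-⊤ H) ⟩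
        induced G S ↷ H                   ∎

    cut-⊥ : (induced G (∁ ⊥) ↷ emptyGraph , induced G ⊥ ↷ H) ≅² (G , H)
    cut-⊥ = ≅ complement , ≅ ideal
      where
      open ≃-Reasoning
      complement : induced G (∁ ⊥) ↷ emptyGraph ≃ G
      complement = begin
        induced G (∁ ⊥) ↷ emptyGraph      ≃⟨ ↷-identityʳ (induced G (∁ ⊥)) ⟩
        induced G (∁ ⊥)                   ≡⟨ cong (induced G) (∁-⊥ m) ⟩
        induced G ⊤                       ≃⟨ induced-⊤ G ⟩
        G                                 ∎
      ideal : induced G ⊥ ↷ H ≃ H
      ideal = begin
        induced G ⊥ ↷ H                   ≃⟨ ↷-cong (induced-⊥ G) ≃-refl ⟩
        emptyGraph ↷ H                    ≃⟨ ↷-identityˡ H ⟩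
        H                                 ∎

    Δ₀-↷ : ∀ c′ →
      map (λ I → (c′ , induced GH (∁ I) , induced GH I)) (ideals GH) ≈₂
      (map (λ T → (c′ , G ↷ induced H (∁ T) , emptyGraph ↷ induced H T)) (ideals H) ++
       map (λ S → (c′ , induced G (∁ S) ↷ emptyGraph , induced G S ↷ H)) (ideals G)) ++
      [ (- c′ , G , H) ]
    Δ₀-↷ c′ = begin
      map cut (ideals GH)
        ≈⟨ ↭⇒≋ (map⁺ cut (ideals-↷ G H)) ⟩
      map cut (map (⊥ ++ᵛ_) (ideals H) ++ map (_++ᵛ ⊤) rest)
        ≡⟨ trans (map-++ cut (map (⊥ ++ᵛ_) (ideals H)) (map (_++ᵛ ⊤) rest))
                 (sym (cong₂ _++_ (map-∘ {g = cut} {f = ⊥ ++ᵛ_} (ideals H)) (map-∘ {g = cut} {f = _++ᵛ ⊤} rest))) ⟩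
      map (λ T → cut (⊥ ++ᵛ T)) (ideals H) ++ map (λ S → cut (S ++ᵛ ⊤)) rest
        ≈⟨ ++-cong (map-cong-≋ (ideals H) (λ T → [-]-cong R.refl (cut-⊥++ T)))
                   (map-cong-≋ rest (λ S → [-]-cong R.refl (cut-++⊤ S))) ⟩
      below ++ map above rest
        ≈⟨ ++-cong {x = below} (≡⇒≈ refl) (++-cong {x = above ⊥ ∷ (- c′ , G , H) ∷ []} cancel (≡⇒≈ refl)) ⟨
      below ++ (above ⊥ ∷ (- c′ , G , H) ∷ map above rest)
        ≈⟨ ↭⇒≋ (++⁺ˡ below (↭-prep (above ⊥) (++-comm [ (- c′ , G , H) ] (map above rest)))) ⟩
      below ++ (above ⊥ ∷ map above rest ++ [ (- c′ , G , H) ])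
        ≡⟨ ++-assoc below (above ⊥ ∷ map above rest) [ (- c′ , G , H) ] ⟨
      (below ++ (above ⊥ ∷ map above rest)) ++ [ (- c′ , G , H) ]
        ≈⟨ ++-cong (++-cong {x = below} (≡⇒≈ refl) (↭⇒≋ (map⁺ above (ideals-↭-∷ G (⊥-isIdeal G))))) (≡⇒≈ refl) ⟨
      (below ++ map above (ideals G)) ++ [ (- c′ , G , H) ] ∎
      where
      open ≈-Reasoning (≋-setoid _≅²_)
      cut : Subset (m +ℕ k) → K × MixedGraph × MixedGraph
      cut I = (c′ , induced GH (∁ I) , induced GH I)
      above : Subset m → K × MixedGraph × MixedGraph
      above S = (c′ , induced G (∁ S) ↷ emptyGraph , induced G S ↷ H)
      below : List (K × MixedGraph × MixedGraph)
      below = map (λ T → (c′ , G ↷ induced H (∁ T) , emptyGraph ↷ induced H T)) (ideals H)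
      rest : List (Subset m)
      rest = filter (λ S → ¬? (S ≟ˢ ⊥)) (ideals G)
      cancel : above ⊥ ∷ (- c′ , G , H) ∷ [] ≈₂ []
      cancel = ≈-trans (++-cong {x = [ above ⊥ ]} ([-]-cong R.refl cut-⊥) (≡⇒≈ refl)) ([a,-a]≋[] c′ (G , H))

  -- The coefficients have the shapes produced by unfolding the bilinear
  -- extensions, e.g. (a * 1#) * (b * 1#) in (x ⊗ 1) ↷ Δ(y).
  Δ₀-↷-scaled : ∀ a b G H →
    scale (a * b) (Δ₀ (G ↷ H)) ≈₂
    (map (λ r → ((a * 1#) * proj₁ r , G ↷ proj₁ (proj₂ r) , emptyGraph ↷ proj₂ (proj₂ r))) (scale b (Δ₀ H)) ++
     map (λ r → (proj₁ r * (1# * b) , proj₁ (proj₂ r) ↷ emptyGraph , proj₂ (proj₂ r) ↷ H)) (scale a (Δ₀ G))) ++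
    [ (- (a * b) , G , H) ]
  Δ₀-↷-scaled a b G H = begin
    scale (a * b) (Δ₀ (G ↷ H))
      ≡⟨ map-∘ (ideals (G ↷ H)) ⟨
    map (λ I → ((a * b) * 1# , induced (G ↷ H) (∁ I) , induced (G ↷ H) I)) (ideals (G ↷ H))
      ≈⟨ map-cong-≋ (ideals (G ↷ H)) (λ I → coeff-cong _ (R.*-identityʳ (a * b))) ⟩
    map (λ I → (a * b , induced (G ↷ H) (∁ I) , induced (G ↷ H) I)) (ideals (G ↷ H))
      ≈⟨ Δ₀-↷ G H (a * b) ⟩
    (map (λ T → (a * b , G ↷ induced H (∁ T) , emptyGraph ↷ induced H T)) (ideals H) ++
     map (λ S → (a * b , induced G (∁ S) ↷ emptyGraph , induced G S ↷ H)) (ideals G)) ++ [ (- (a * b) , G , H) ]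
      ≈⟨ ++-cong (++-cong
           (map-cong-≋ (ideals H) (λ T → coeff-cong _ (R.*-cong (R.*-identityʳ a) (R.*-identityʳ b))))
           (map-cong-≋ (ideals G) (λ S → coeff-cong _ (R.*-cong (R.*-identityʳ a) (R.*-identityˡ b)))))
         (≡⇒≈ refl) ⟨
    (map (λ T → ((a * 1#) * (b * 1#) , G ↷ induced H (∁ T) , emptyGraph ↷ induced H T)) (ideals H) ++
     map (λ S → ((a * 1#) * (1# * b) , induced G (∁ S) ↷ emptyGraph , induced G S ↷ H)) (ideals G)) ++
    [ (- (a * b) , G , H) ]
      ≡⟨ cong₂ (λ xs ys → (xs ++ ys) ++ _) (map-map-map _ _ _ (ideals H)) (map-map-map _ _ _ (ideals G)) ⟨
    _ ∎
    where open ≈-Reasoning (≋-setoid _≅²_)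

  module _ (x y : 𝓕) where
    private
      Term : Set c
      Term = K × MixedGraph → K × MixedGraph → 𝓕⊗𝓕

      ΣΣ : Term → 𝓕⊗𝓕
      ΣΣ T = concatMap (λ p → concatMap (T p) y) x

      whole left right cross : Term
      whole (a , G) (b , H) = scale (a * b) (Δ₀ (G ↷ H))
      left  (a , G) (b , H) =
        map (λ r → ((a * 1#) * proj₁ r , G ↷ proj₁ (proj₂ r) , emptyGraph ↷ proj₂ (proj₂ r))) (scale b (Δ₀ H))
      right (a , G) (b , H) =
        map (λ r → (proj₁ r * (1# * b) , proj₁ (proj₂ r) ↷ emptyGraph , proj₂ (proj₂ r) ↷ H)) (scale a (Δ₀ G))
      cross (a , G) (b , H) = [ (- (a * b) , G , H) ]

      Δ-⋅ : Δ (x ⋅ y) ≡ ΣΣ whole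
      Δ-⋅ = trans (concatMap-concatMap _ _ x) (concatMap-cong (λ p → concatMap-map _ _ y) x)

      ⊗𝟙-⋅²-Δ : (x ⊗ 𝟙) ⋅² Δ y ≡ ΣΣ left
      ⊗𝟙-⋅²-Δ = trans (concatMap-concatMap _ _ x)
        (concatMap-cong (λ p → trans (++-identityʳ _) (map-concatMap _ _ y)) x)

      Δ-⋅²-𝟙⊗ : Δ x ⋅² (𝟙 ⊗ y) ≈₂ ΣΣ right
      Δ-⋅²-𝟙⊗ = ≈-trans (≡⇒≈ (concatMap-concatMap _ _ x)) (concatMap-cong-≋ x (λ { (a , G) → ↭⇒≋ (↭-trans
        (↭-reflexive (concatMap-cong (λ r → trans (cong (map _) (++-identityʳ _)) (sym (map-∘ y))) (scale a (Δ₀ G))))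
        (concatMap-map-comm _ (scale a (Δ₀ G)) y)) }))

      neg-⊗ : neg (x ⊗ y) ≡ ΣΣ cross
      neg-⊗ = trans (map-concatMap _ _ x) (concatMap-cong (λ p → trans (sym (map-∘ y)) (map≡concatMap _ y)) x)

    ↷-Δ-compatible : Δ (x ⋅ y) ≈₂ ((x ⊗ 𝟙) ⋅² Δ y ++ Δ x ⋅² (𝟙 ⊗ y)) ++ neg (x ⊗ y)
    ↷-Δ-compatible = begin
      Δ (x ⋅ y)
        ≡⟨ Δ-⋅ ⟩
      ΣΣ whole
        ≈⟨ concatMap-cong-≋ x (λ { (a , G) → concatMap-cong-≋ y (λ { (b , H) → Δ₀-↷-scaled a b G H }) }) ⟩
      ΣΣ (λ p q → (left p q ++ right p q) ++ cross p q)
        ≈⟨ ↭⇒≋ (double-sum-++ (λ p q → left p q ++ right p q) cross) ⟨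
      ΣΣ (λ p q → left p q ++ right p q) ++ ΣΣ cross
        ≈⟨ ++-cong (↭⇒≋ (double-sum-++ left right)) (≡⇒≈ refl) ⟨
      (ΣΣ left ++ ΣΣ right) ++ ΣΣ cross
        ≈⟨ ++-cong (++-cong (≡⇒≈ ⊗𝟙-⋅²-Δ) Δ-⋅²-𝟙⊗) (≡⇒≈ neg-⊗) ⟨
      ((x ⊗ 𝟙) ⋅² Δ y ++ Δ x ⋅² (𝟙 ⊗ y)) ++ neg (x ⊗ y) ∎
      where
      open ≈-Reasoning (≋-setoid _≅²_)
      double-sum-++ : (T T′ : Term) → ΣΣ T ++ ΣΣ T′ ↭ ΣΣ (λ p q → T p q ++ T′ p q)
      double-sum-++ T T′ = ↭-trans (concatMap-++-↭ _ _ x)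
        (concatMap-cong-↭ x (λ p → concatMap-++-↭ (T p) (T′ p) y))

-- The argument works over any commutative ring.
proposition1p8 : ∀ {c ℓ} (R : CommutativeRing c ℓ) → IsField R →
    let open GraphBialgebra R in
    -- ↷ is associative with unit 1
    (∀ x y z → (x ⋅ y) ⋅ z ≈₁ x ⋅ (y ⋅ z)) ×
    (∀ x → 𝟙 ⋅ x ≈₁ x) × (∀ x → x ⋅ 𝟙 ≈₁ x) ×
    -- Δ is coassociative and counital (counit ε)
    (∀ x → Δ⊗id (Δ x) ≈₃ id⊗Δ (Δ x)) ×
    (∀ x → ε⊗id (Δ x) ≈₁ x) × (∀ x → id⊗ε (Δ x) ≈₁ x) ×
    -- the infinitesimal compatibility
    (∀ x y → Δ (x ⋅ y) ≈₂ ((x ⊗ 𝟙) ⋅² Δ y ++ Δ x ⋅² (𝟙 ⊗ y)) ++ neg (x ⊗ y))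
proposition1p8 R _ =
  ⋅-assoc , ⋅-identityˡ , ⋅-identityʳ , Δ-coassoc , Δ-counitˡ , Δ-counitʳ , ↷-Δ-compatible
  where open Bialgebra R
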